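{- Let $n\ge1$ and for $\mu\in\mathbb{N}^n$ let $$C_{\mu }(x;q,t) = \sum _{\substack{\sigma \colon \mathrm{dg}'(\mu) \rightarrow [n]\\ \text{non-attacking}}} x^{\sigma } q^{\mathrm{maj} (\widehat{\sigma })} t^{\mathrm{coinv}(\widehat{\sigma })} \prod _{\substack{u\in \mathrm{dg}' (\mu )\\ \widehat{\sigma }(u)\not =\widehat{\sigma }(d(u))}} \frac{1-t}{1-q^{l(u)+1}t^{a(u)+1}}.$$ Then for every $\mu\in\mathbb{N}^n$, $C_{\pi(\mu)}(x;q,t)=q^{\mu_n}x_1C_\mu(x_2,\dots,x_n,q^{ -1}x_1;q,t)$, where $\pi(\mu)=(\mu_n+1,\mu_1,\dots,\mu_{n-1})$.
   Context: $q,t$ are indeterminates. For $\mu\in\mathbb{N}^n$, $\mathrm{dg}'(\mu)=\{(i,j)\in\mathbb{N}^2:1\le i\le n,\ 1\le j\le\mu_i\}$, $\widehat{\mathrm{dg}}(\mu)=\mathrm{dg}'(\mu)\cup\{(i,0):1\le i\le n\}$, $d((i,j))=(i,j-1)$. For $u=(i,j)\in\mathrm{dg}'(\mu)$: $l(u)=\mu_i-j$, $a(u)=|\{(i',j)\in\mathrm{dg}'(\mu):i'<i,\ \mu_{i'}\le\mu_i\}|+|\{(i',j-1)\in\widehat{\mathrm{dg}}(\mu):i'>i,\ \mu_{i'}<\mu_i\}|$. Distinct boxes attack each other if in the same row, or of the form $(i,j),(i',j-1)$ with $i<i'$. Reading order: $(i,j)$ precedes $(i',j')$ iff $j>j'$,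 or $j=j'$ and $i>i'$. A filling $\sigma:\mathrm{dg}'(\mu)\to[n]$ has augmented filling $\widehat\sigma$ extending it with $\widehat\sigma((i,0))=i$; non-attacking means $\widehat\sigma(u)\ne\widehat\sigma(v)$ for attacking $u,v\in\widehat{\mathrm{dg}}(\mu)$. Descents: $u\in\mathrm{dg}'(\mu)$ with $\widehat\sigma(u)>\widehat\sigma(d(u))$; $\mathrm{maj}(\widehat\sigma)=\sum_{u\in\mathrm{Des}(\widehat\sigma)}(l(u)+1)$. Inversions: attacking $u,v\in\widehat{\mathrm{dg}}(\mu)$, $u$ preceding $v$ in reading order, $\widehat\sigma(u)>\widehat\sigma(v)$. $\mathrm{inv}(\widehat\sigma)=|\mathrm{Inv}(\widehat\sigma)|-|\{(i,j):i<j,\ \mu_i\le\mu_j\}|-\sum_{u\in\mathrm{Des}(\widehat\sigma)}a(u)$; $\mathrm{coinv}(\widehat\sigma)=\sum_{u\in\mathrm{dg}'(\mu)}a(u)-\mathrm{inv}(\widehat\sigma)$; $x^\sigma=\prod_{u\in\mathrm{dg}'(\mu)}x_{\sigma(u)}$. -}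

module Defs where

open import Data.Bool using (Bool; true; false; if_then_else_; _∧_; _∨_; not)
open import Data.Nat as ℕ using (ℕ; zero; suc; _≡ᵇ_; _<ᵇ_; _≤ᵇ_; _∸_)
open import Data.Integer as ℤ using (ℤ; +_; -[1+_])
open import Data.Rational as ℚ using (ℚ; 0ℚ; 1ℚ; _*_; _-_; 1/_; ≢-nonZero)
open import Data.Rational.Properties using (_≟_)
open import Data.List as L using (List; []; _∷_; map; concatMap; filter; length; upTo; foldr; _++_; allFin; zip)
open import Data.Vec as V using (Vec)
open import Data.Product using (_×_; _,_; proj₁; proj₂)
open import Relation.Nullary using (yes; no)
open import Relation.Nullary.Decidable using (does)
open import Relation.Unary using (Decidable)

_^_ : ℚ → ℕ → ℚ
p ^ zero  = 1ℚ
p ^ suc k = p * (p ^ k)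
infixr 8 _^_

-- inverse, total: inv 0 = 0 (only ever used at nonzero arguments under
-- the hypotheses of the theorem)
inv : ℚ → ℚ
inv p with p ≟ 0ℚ
... | yes _  = 0ℚ
... | no p≢0 = 1/_ p {{≢-nonZero p≢0}}

_^ℤ_ : ℚ → ℤ → ℚ
p ^ℤ (+ k)     = p ^ k
p ^ℤ -[1+ k ]  = inv (p ^ suc k)

sumℚ : List ℚ → ℚ
sumℚ = foldr ℚ._+_ 0ℚ

prodℚ : List ℚ → ℚ
prodℚ = foldr _*_ 1ℚ

sumℕ : List ℕ → ℕ
sumℕ = foldr ℕ._+_ 0

count : {A : Set} → (A → Bool) → List A → ℕ
count p xs = length (L.filterᵇ p xs)

allᵇ : {A : Set} → (A → Bool) → List A → Bool
allᵇ p = foldr (λ a b → p a ∧ b) true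

range1 : ℕ → List ℕ
range1 k = map suc (upTo k)

-- Compositions μ ∈ ℕ^n are given as lists (μ_1,…,μ_n); boxes are pairs
-- (i , j) of naturals, 1-indexed column i, row j.

Box : Set
Box = ℕ × ℕ

-- μ_i (1-indexed), 0 outside the range
at : List ℕ → ℕ → ℕ
at []       _             = 0
at (m ∷ ms) zero          = 0
at (m ∷ ms) (suc zero)    = m
at (m ∷ ms) (suc (suc i)) = at ms (suc i)

dg' : List ℕ → List Box
dg' μ = concatMap (λ i → map (λ j → (i , j)) (range1 (at μ i))) (range1 (length μ))

dgHat : List ℕ → List Box
dgHat μ = dg' μ ++ map (λ i → (i , 0)) (range1 (length μ))

eqBox : Box → Box → Bool
eqBox (i , j) (i' , j') = (i ≡ᵇ i') ∧ (j ≡ᵇ j')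

d : Box → Box
d (i , j) = (i , j ∸ 1)

leg : List ℕ → Box → ℕ
leg μ (i , j) = at μ i ∸ j

arm : List ℕ → Box → ℕ
arm μ (i , j) =
  count (λ { (i' , j') → (j' ≡ᵇ j) ∧ (i' <ᵇ i) ∧ (at μ i' ≤ᵇ at μ i) }) (dg' μ)
  ℕ.+ count (λ { (i' , j') → (j' ℕ.+ 1 ≡ᵇ j) ∧ (i <ᵇ i') ∧ (at μ i' <ᵇ at μ i) }) (dgHat μ)

attackForm : Box → Box → Bool
attackForm (i , j) (i' , j') = (j' ℕ.+ 1 ≡ᵇ j) ∧ (i <ᵇ i')

attacks : Box → Box → Bool
attacks u v = not (eqBox u v) ∧
  (((proj₂ u) ≡ᵇ (proj₂ v)) ∨ attackForm u v ∨ attackForm v u)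

precedes : Box → Box → Bool
precedes (i , j) (i' , j') = (j' <ᵇ j) ∨ ((j ≡ᵇ j') ∧ (i' <ᵇ i))

-- Fillings σ : dg'(μ) → [n], represented as a list of values, the k-th
-- value being σ of the k-th box of dg' μ.

words : ℕ → ℕ → List (List ℕ)
words n zero    = [] ∷ []
words n (suc k) = concatMap (λ a → map (a ∷_) (words n k)) (range1 n)

Filling : Set
Filling = List (Box × ℕ)

fillings : List ℕ → List Filling
fillings μ = map (zip (dg' μ)) (words (length μ) (length (dg' μ)))

lookupF : Filling → Box → ℕ
lookupF []             u = 0
lookupF ((v , a) ∷ σ) u = if eqBox u v then a else lookupF σ u

hat : Filling → Box → ℕ
hat σ (i , zero)  = i
hat σ (i , suc j) = lookupF σ (i , suc j)

nonAttacking : List ℕ → Filling → Bool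
nonAttacking μ σ =
  allᵇ (λ u → allᵇ (λ v → not (attacks u v) ∨ not (hat σ u ≡ᵇ hat σ v)) (dgHat μ)) (dgHat μ)

Des : List ℕ → Filling → List Box
Des μ σ = L.filterᵇ (λ u → hat σ (d u) <ᵇ hat σ u) (dg' μ)

maj : List ℕ → Filling → ℕ
maj μ σ = sumℕ (map (λ u → suc (leg μ u)) (Des μ σ))

numInv : List ℕ → Filling → ℕ
numInv μ σ = sumℕ (map (λ u → count (λ v → attacks u v ∧ precedes u v ∧ (hat σ v <ᵇ hat σ u)) (dgHat μ)) (dgHat μ))

numPairs : List ℕ → ℕ
numPairs μ = sumℕ (map (λ i → count (λ j → (i <ᵇ j) ∧ (at μ i ≤ᵇ at μ j)) (range1 (length μ))) (range1 (length μ)))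

invStat : List ℕ → Filling → ℤ
invStat μ σ = (+ numInv μ σ) ℤ.- (+ numPairs μ) ℤ.- (+ sumℕ (map (arm μ) (Des μ σ)))

coinv : List ℕ → Filling → ℤ
coinv μ σ = (+ sumℕ (map (arm μ) (dg' μ))) ℤ.- invStat μ σ

-- x_k, 1-indexed
xAt : List ℚ → ℕ → ℚ
xAt []       _             = 0ℚ
xAt (a ∷ as) zero          = 0ℚ
xAt (a ∷ as) (suc zero)    = a
xAt (a ∷ as) (suc (suc k)) = xAt as (suc k)

term : List ℕ → List ℚ → ℚ → ℚ → Filling → ℚ
term μ x q t σ =
  prodℚ (map (λ u → xAt x (hat σ u)) (dg' μ))
  * (q ^ maj μ σ)
  * (t ^ℤ coinv μ σ)
  * prodℚ (map (λ u → (1ℚ - t) * inv (1ℚ - (q ^ suc (leg μ u)) * (t ^ suc (arm μ u))))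
               (L.filterᵇ (λ u → not (hat σ u ≡ᵇ hat σ (d u))) (dg' μ)))

Cℓ : List ℕ → List ℚ → ℚ → ℚ → ℚ
Cℓ μ x q t = sumℚ (map (term μ x q t) (L.filterᵇ (nonAttacking μ) (fillings μ)))

C : {n : ℕ} → Vec ℕ n → Vec ℚ n → ℚ → ℚ → ℚ
C μ x q t = Cℓ (V.toList μ) (V.toList x) q t

π : {m : ℕ} → Vec ℕ (suc m) → Vec ℕ (suc m)
π μ = suc (V.last μ) V.∷ V.init μ

shiftX : {m : ℕ} → ℚ → Vec ℚ (suc m) → Vec ℚ (suc m)
shiftX q x = V.tail x V.∷ʳ (inv q * V.head x)

{-# OPTIONS --safe #-}
-- Write μ = ν ++ [ c ] and μ' = π μ = suc c ∷ ν, and let n be the number of columns. In a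
-- non-attacking filling of μ' the box (1 , 1) attacks every base box (a , 0) with a > 1, so it
-- holds 1. Deleting it, moving the first column to the end and lowering the values cyclically
-- (1 ↦ n, a + 1 ↦ a) is a bijection σ' ↦ σ onto the fillings of μ which preserves being
-- non-attacking, legs and arms, hence the factors with t. If N boxes of σ hold the value n, then
-- x^σ' = x₁ q^N · x^σ(x₂, …, xₙ, q⁻¹ x₁), and maj σ' + N = maj σ + c by telescoping the legs up each
-- column. Finally coinv σ' = coinv σ: relabelling changes exactly the inversions that involve the
-- value n, and column by column these are balanced against the arms of the boxes holding n.
module Submission where

open import Algebra.Core using (Op₂)
open import Algebra.Structures using (IsCommutativeMonoid)
open import Data.Bool using (Bool; true; false; if_then_else_; _∧_; _∨_; not; T)
import Data.Bool.Properties as Bool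
open import Data.Empty using (⊥-elim)
import Data.Integer as ℤ
import Data.Integer.Tactic.RingSolver as ℤSolver
open import Data.List using (List; []; _∷_; [_]; map; concat; concatMap; zip; foldr; _++_; length; filterᵇ; upTo)
import Data.List.Properties as List
open import Data.List.Membership.Propositional using (_∈_)
open import Data.List.Membership.Propositional.Properties
  using (∈-map⁺; ∈-map⁻; ∈-upTo⁺; ∈-upTo⁻; ∈-++⁺ˡ; ∈-++⁺ʳ; ∈-concatMap⁺)
open import Data.List.Relation.Binary.Permutation.Propositional
  using (_↭_; ↭⇒↭ₛ′; prep; ↭-sym; ↭-trans; ↭-reflexive)
import Data.List.Relation.Binary.Permutation.Propositional.Properties as ↭
import Data.List.Relation.Binary.Permutation.Setoid.Properties as ↭ₛ
open import Data.List.Relation.Unary.All as All using (All; []; _∷_)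
import Data.List.Relation.Unary.All.Properties as All
open import Data.List.Relation.Unary.Any as Any using (here; there)
open import Data.Nat as ℕ using (ℕ; zero; suc; _+_; _∸_; _≤_; _<_; z≤n; s≤s; _≡ᵇ_; _<ᵇ_; _≤ᵇ_)
import Data.Nat.Properties as ℕ
open import Data.Nat.Tactic.RingSolver using (solve-∀)
open import Data.Product using (_×_; _,_; proj₁; proj₂)
import Data.Product as Product
open import Data.Rational as ℚ using (ℚ; 0ℚ; 1ℚ; _*_; _-_)
import Data.Rational.Properties as ℚ
open import Data.Rational.Solver using (module +-*-Solver)
open import Data.Sum using (inj₁; inj₂)
open import Data.Vec as Vec using (Vec; head; last; _∷_)
import Data.Vec.Properties as Vec
open import Function using (_∘_; id; case_of_)
open import Relation.Binary using (tri<; tri≈; tri>)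
open import Relation.Binary.PropositionalEquality hiding ([_])
open import Relation.Nullary using (yes; no)
open import Relation.Nullary.Decidable using (dec-true; dec-false)

open import Defs

private
  variable
    B D : Set
    xs ys : List B

module BigOperator {A : Set} {_∙_ : Op₂ A} {ε : A} (isCM : IsCommutativeMonoid _≡_ _∙_ ε) where
  open IsCommutativeMonoid isCM using (assoc; comm; identityˡ; identityʳ)
  open ≡-Reasoning

  ⨁ : (B → A) → List B → A
  ⨁ f xs = foldr _∙_ ε (map f xs)

  ⨁-↭ : (f : B → A) → xs ↭ ys → ⨁ f xs ≡ ⨁ f ys
  ⨁-↭ f p = ↭ₛ.foldr-commMonoid (setoid A) isCM (↭⇒↭ₛ′ isEquivalence (↭.map⁺ f p))

  ⨁-++ : (f : B → A) (xs ys : List B) → ⨁ f (xs ++ ys) ≡ ⨁ f xs ∙ ⨁ f ys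
  ⨁-++ f []       ys = sym (identityˡ _)
  ⨁-++ f (x ∷ xs) ys = trans (cong (f x ∙_) (⨁-++ f xs ys)) (sym (assoc (f x) _ _))

  ⨁-map : (f : D → A) (g : B → D) (xs : List B) → ⨁ f (map g xs) ≡ ⨁ (f ∘ g) xs
  ⨁-map f g xs = cong (foldr _∙_ ε) (sym (List.map-∘ xs))

  ⨁-concatMap : (f : D → A) (g : B → List D) (xs : List B) →
                ⨁ f (concatMap g xs) ≡ ⨁ (λ x → ⨁ f (g x)) xs
  ⨁-concatMap f g []       = refl
  ⨁-concatMap f g (x ∷ xs) = trans (⨁-++ f (g x) _) (cong (⨁ f (g x) ∙_) (⨁-concatMap f g xs))

  ⨁-cong-local : {f g : B → A} → All (λ x → f x ≡ g x) xs → ⨁ f xs ≡ ⨁ g xs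
  ⨁-cong-local []         = refl
  ⨁-cong-local (e ∷ es) = cong₂ _∙_ e (⨁-cong-local es)

  ⨁-cong : {f g : B → A} → (∀ x → f x ≡ g x) → (xs : List B) → ⨁ f xs ≡ ⨁ g xs
  ⨁-cong e xs = ⨁-cong-local (All.universal e xs)

  ⨁-ε : {f : B → A} → All (λ x → f x ≡ ε) xs → ⨁ f xs ≡ ε
  ⨁-ε []         = refl
  ⨁-ε (e ∷ es) = trans (cong₂ _∙_ e (⨁-ε es)) (identityˡ ε)

  ⨁-∙ : (f g : B → A) (xs : List B) → ⨁ (λ x → f x ∙ g x) xs ≡ ⨁ f xs ∙ ⨁ g xs
  ⨁-∙ f g []       = sym (identityˡ ε)
  ⨁-∙ f g (x ∷ xs) = begin
    (f x ∙ g x) ∙ ⨁ (λ x → f x ∙ g x) xs  ≡⟨ cong ((f x ∙ g x) ∙_) (⨁-∙ f g xs) ⟩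
    (f x ∙ g x) ∙ (⨁ f xs ∙ ⨁ g xs)        ≡⟨ interchange (f x) (g x) _ _ ⟩
    (f x ∙ ⨁ f xs) ∙ (g x ∙ ⨁ g xs)        ∎
    where
    interchange : ∀ a b c d → (a ∙ b) ∙ (c ∙ d) ≡ (a ∙ c) ∙ (b ∙ d)
    interchange a b c d = begin
      (a ∙ b) ∙ (c ∙ d)  ≡⟨ assoc a b _ ⟩
      a ∙ (b ∙ (c ∙ d))  ≡⟨ cong (a ∙_) (sym (assoc b c d)) ⟩
      a ∙ ((b ∙ c) ∙ d)  ≡⟨ cong (λ z → a ∙ (z ∙ d)) (comm b c) ⟩
      a ∙ ((c ∙ b) ∙ d)  ≡⟨ cong (a ∙_) (assoc c b d) ⟩
      a ∙ (c ∙ (b ∙ d))  ≡⟨ sym (assoc a c _) ⟩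
      (a ∙ c) ∙ (b ∙ d)  ∎

  ⨁-comm : (F : B → D → A) (xs : List B) (ys : List D) →
           ⨁ (λ x → ⨁ (F x) ys) xs ≡ ⨁ (λ y → ⨁ (λ x → F x y) xs) ys
  ⨁-comm F []       ys = sym (⨁-ε (All.universal (λ _ → refl) ys))
  ⨁-comm F (x ∷ xs) ys = trans (cong (⨁ (F x) ys ∙_) (⨁-comm F xs ys)) (sym (⨁-∙ (F x) _ ys))

  ⨁-filterᵇ : (f : B → A) (p : B → Bool) (xs : List B) →
              ⨁ f (filterᵇ p xs) ≡ ⨁ (λ x → if p x then f x else ε) xs
  ⨁-filterᵇ f p []       = refl
  ⨁-filterᵇ f p (x ∷ xs) with p x
  ... | true  = cong (f x ∙_) (⨁-filterᵇ f p xs)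
  ... | false = trans (⨁-filterᵇ f p xs) (sym (identityˡ _))

  ⨁-homo : (h : A → A) → h ε ≡ ε → (∀ a b → h (a ∙ b) ≡ h a ∙ h b) →
           (f : B → A) (xs : List B) → h (⨁ f xs) ≡ ⨁ (h ∘ f) xs
  ⨁-homo h h-ε h-∙ f []       = h-ε
  ⨁-homo h h-ε h-∙ f (x ∷ xs) = trans (h-∙ (f x) _) (cong (h (f x) ∙_) (⨁-homo h h-ε h-∙ f xs))

  ⨁-words-+ : ∀ n a b (F : List ℕ → A) →
              ⨁ F (words n (a + b)) ≡ ⨁ (λ u → ⨁ (λ v → F (u ++ v)) (words n b)) (words n a)
  ⨁-words-+ n zero    b F = sym (identityʳ _)
  ⨁-words-+ n (suc a) b F = begin
    ⨁ F (concatMap (λ x → map (x ∷_) (words n (a + b))) (range1 n))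
      ≡⟨ ⨁-concatMap F (λ x → map (x ∷_) (words n (a + b))) (range1 n) ⟩
    ⨁ (λ x → ⨁ F (map (x ∷_) (words n (a + b)))) (range1 n)
      ≡⟨ ⨁-cong (λ x → trans (⨁-map F (x ∷_) (words n (a + b))) (⨁-words-+ n a b (F ∘ (x ∷_)))) (range1 n) ⟩
    ⨁ (λ x → ⨁ (G ∘ (x ∷_)) (words n a)) (range1 n)
      ≡⟨ sym (⨁-cong (λ x → ⨁-map G (x ∷_) (words n a)) (range1 n)) ⟩
    ⨁ (λ x → ⨁ G (map (x ∷_) (words n a))) (range1 n)
      ≡⟨ sym (⨁-concatMap G (λ x → map (x ∷_) (words n a)) (range1 n)) ⟩
    ⨁ G (words n (suc a)) ∎
    where
    G : List ℕ → A
    G u = ⨁ (λ v → F (u ++ v)) (words n b)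

  ⨁-words-map : ∀ n (s : ℕ → ℕ) → map s (range1 n) ↭ range1 n →
                ∀ k (F : List ℕ → A) → ⨁ (F ∘ map s) (words n k) ≡ ⨁ F (words n k)
  ⨁-words-map n s s↭ zero    F = refl
  ⨁-words-map n s s↭ (suc k) F = begin
    ⨁ (F ∘ map s) (concatMap (λ x → map (x ∷_) (words n k)) (range1 n))
      ≡⟨ ⨁-concatMap (F ∘ map s) (λ x → map (x ∷_) (words n k)) (range1 n) ⟩
    ⨁ (λ x → ⨁ (F ∘ map s) (map (x ∷_) (words n k))) (range1 n)
      ≡⟨ ⨁-cong (λ x → trans (⨁-map (F ∘ map s) (x ∷_) (words n k)) (⨁-words-map n s s↭ k (F ∘ (s x ∷_)))) (range1 n) ⟩
    ⨁ (G ∘ s) (range1 n)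
      ≡⟨ trans (sym (⨁-map G s (range1 n))) (⨁-↭ G s↭) ⟩
    ⨁ G (range1 n)
      ≡⟨ sym (⨁-cong (λ x → ⨁-map F (x ∷_) (words n k)) (range1 n)) ⟩
    ⨁ (λ x → ⨁ F (map (x ∷_) (words n k))) (range1 n)
      ≡⟨ sym (⨁-concatMap F (λ x → map (x ∷_) (words n k)) (range1 n)) ⟩
    ⨁ F (words n (suc k)) ∎
    where
    G : ℕ → A
    G y = ⨁ (λ w → F (y ∷ w)) (words n k)

open BigOperator ℕ.+-0-isCommutativeMonoid

∷-++-∷-↭ : ∀ (a b : B) A B → (a ∷ A) ++ (b ∷ B) ↭ b ∷ (A ++ (B ++ [ a ]))
∷-++-∷-↭ a b A B = ↭-trans (↭.shift b (a ∷ A) B)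
  (prep b (↭-trans (↭.∷↭∷ʳ a (A ++ B)) (↭-reflexive (List.++-assoc A B [ a ]))))

⟦_⟧ : Bool → ℕ
⟦ true  ⟧ = 1
⟦ false ⟧ = 0

count≡⨁⟦⟧ : (p : B → Bool) (xs : List B) → count p xs ≡ ⨁ (⟦_⟧ ∘ p) xs
count≡⨁⟦⟧ p []       = refl
count≡⨁⟦⟧ p (x ∷ xs) with p x
... | true  = cong suc (count≡⨁⟦⟧ p xs)
... | false = count≡⨁⟦⟧ p xs

⟦∧⟧≡if : ∀ a b → ⟦ a ∧ b ⟧ ≡ (if b then ⟦ a ⟧ else 0)
⟦∧⟧≡if true  true  = refl
⟦∧⟧≡if true  false = refl
⟦∧⟧≡if false true  = refl
⟦∧⟧≡if false false = refl

⟦∨⟧-exclusive : ∀ a b x y → a ∧ b ≡ false → ⟦ (a ∧ x) ∨ (b ∧ y) ⟧ ≡ ⟦ a ∧ x ⟧ + ⟦ b ∧ y ⟧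
⟦∨⟧-exclusive false b     x     y _ = refl
⟦∨⟧-exclusive true  false true  y _ = refl
⟦∨⟧-exclusive true  false false y _ = refl

⨁-if : ∀ b (f : B → ℕ) xs → ⨁ (λ x → if b then f x else 0) xs ≡ (if b then ⨁ f xs else 0)
⨁-if true  f xs = refl
⨁-if false f xs = ⨁-ε (All.universal (λ _ → refl) xs)

if≡⟦⟧* : ∀ b w → (if b then w else 0) ≡ ⟦ b ⟧ ℕ.* w
if≡⟦⟧* true  w = sym (ℕ.+-identityʳ w)
if≡⟦⟧* false w = refl

+-swap-unless : ∀ b x y → (b ≡ false → x ≡ y) → x + (if b then y else 0) ≡ y + (if b then x else 0)
+-swap-unless true  x y _   = ℕ.+-comm x y
+-swap-unless false x y x≡y = cong (_+ 0) (x≡y refl)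

∧false∨∧true : ∀ x y → (x ∧ false) ∨ (y ∧ true) ≡ y
∧false∨∧true x y rewrite Bool.∧-zeroʳ x | Bool.∧-identityʳ y = refl

∧true∨∧false : ∀ x y → (x ∧ true) ∨ (y ∧ false) ≡ x
∧true∨∧false x y rewrite Bool.∧-identityʳ x | Bool.∧-zeroʳ y = Bool.∨-identityʳ x

≡ᵇ-refl : ∀ a → (a ≡ᵇ a) ≡ true
≡ᵇ-refl a = dec-true (a ℕ.≟ a) refl

≢⇒≡ᵇ-false : ∀ {a b} → a ≢ b → (a ≡ᵇ b) ≡ false
≢⇒≡ᵇ-false {a} {b} = dec-false (a ℕ.≟ b)

≡ᵇ-sym : ∀ a b → (a ≡ᵇ b) ≡ (b ≡ᵇ a)
≡ᵇ-sym zero    zero    = refl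
≡ᵇ-sym zero    (suc b) = refl
≡ᵇ-sym (suc a) zero    = refl
≡ᵇ-sym (suc a) (suc b) = ≡ᵇ-sym a b

<⇒<ᵇ-true : ∀ {a b} → a < b → (a <ᵇ b) ≡ true
<⇒<ᵇ-true {a} {b} = dec-true (a ℕ.<? b)

≤⇒<ᵇ-false : ∀ {a b} → b ≤ a → (a <ᵇ b) ≡ false
≤⇒<ᵇ-false {a} {b} b≤a = dec-false (a ℕ.<? b) (ℕ.≤⇒≯ b≤a)

<ᵇ-irrefl : ∀ a → (a <ᵇ a) ≡ false
<ᵇ-irrefl a = ≤⇒<ᵇ-false (ℕ.≤-refl {a})

<ᵇ-suc : ∀ a b → (a <ᵇ suc b) ≡ (a ≤ᵇ b)
<ᵇ-suc zero    b = refl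
<ᵇ-suc (suc a) b = refl

<ᵇ-false⇒≥ : ∀ a b → (a <ᵇ b) ≡ false → b ≤ a
<ᵇ-false⇒≥ a b e = ℕ.≮⇒≥ (λ a<b → subst T e (ℕ.<⇒<ᵇ a<b))

≤ᵇ-false⇒> : ∀ a b → (a ≤ᵇ b) ≡ false → b < a
≤ᵇ-false⇒> a b e = ℕ.≰⇒> (λ a≤b → subst T e (ℕ.≤⇒≤ᵇ a≤b))

≤ᵇ-true⇒≤ : ∀ a b → (a ≤ᵇ b) ≡ true → a ≤ b
≤ᵇ-true⇒≤ a b e = ℕ.≤ᵇ⇒≤ a b (subst T (sym e) _)

<ᵇ-true⇒< : ∀ a b → (a <ᵇ b) ≡ true → a < b
<ᵇ-true⇒< a b e = ℕ.<ᵇ⇒< a b (subst T (sym e) _)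

if-∧-zero : ∀ a b {x} → (b ≡ true → x ≡ 0) → (if a ∧ b then x else 0) ≡ 0
if-∧-zero false b     _    = refl
if-∧-zero true  false _    = refl
if-∧-zero true  true  x≡0 = x≡0 refl

_∈[1,_] : ℕ → ℕ → Set
i ∈[1, k ] = 1 ≤ i × i ≤ k

upTo-suc : ∀ N → upTo (suc N) ≡ 0 ∷ map suc (upTo N)
upTo-suc N = cong (0 ∷_) (sym (List.map-applyUpTo id suc N))

range1-suc : ∀ k → range1 (suc k) ≡ 1 ∷ map suc (range1 k)
range1-suc k = cong (map suc) (upTo-suc k)

range1-∷ʳ : ∀ k → range1 (suc k) ≡ range1 k ++ [ suc k ]
range1-∷ʳ k = trans (cong (map suc) (sym (List.upTo-∷ʳ k))) (List.map-++ suc (upTo k) [ k ])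

length-range1 : ∀ k → length (range1 k) ≡ k
length-range1 k = trans (List.length-map suc (upTo k)) (List.length-upTo k)

range1-bounds : ∀ k → All (_∈[1, k ]) (range1 k)
range1-bounds k = All.tabulate λ i∈ → case ∈-map⁻ suc i∈ of λ where
  (_ , i∈upTo , refl) → s≤s z≤n , ∈-upTo⁻ i∈upTo

∈-range1 : ∀ {i k} → i ∈[1, k ] → i ∈ range1 k
∈-range1 {suc i} (_ , i<k) = ∈-map⁺ suc (∈-upTo⁺ i<k)

#≡ᵇ-upTo : ∀ J N → ⨁ (λ k → ⟦ k ≡ᵇ J ⟧) (upTo N) ≡ ⟦ J <ᵇ N ⟧
#≡ᵇ-upTo J       zero    = refl
#≡ᵇ-upTo zero    (suc N) = trans (cong (⨁ (λ k → ⟦ k ≡ᵇ 0 ⟧)) (upTo-suc N))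
  (cong suc (trans (⨁-map (λ k → ⟦ k ≡ᵇ 0 ⟧) suc (upTo N)) (⨁-ε (All.universal (λ _ → refl) (upTo N)))))
#≡ᵇ-upTo (suc J) (suc N) = trans (cong (⨁ (λ k → ⟦ k ≡ᵇ suc J ⟧)) (upTo-suc N))
  (trans (⨁-map (λ k → ⟦ k ≡ᵇ suc J ⟧) suc (upTo N)) (#≡ᵇ-upTo J N))

⨁-1≡length : (xs : List B) → ⨁ (λ _ → 1) xs ≡ length xs
⨁-1≡length []       = refl
⨁-1≡length (x ∷ xs) = cong suc (⨁-1≡length xs)

⟦<ᵇ⟧+⟦≤ᵇ⟧ : ∀ a b → ⟦ a <ᵇ b ⟧ + ⟦ b ≤ᵇ a ⟧ ≡ 1
⟦<ᵇ⟧+⟦≤ᵇ⟧ a       zero    = refl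
⟦<ᵇ⟧+⟦≤ᵇ⟧ zero    (suc b) = refl
⟦<ᵇ⟧+⟦≤ᵇ⟧ (suc a) (suc b) = trans (cong (λ x → ⟦ a <ᵇ b ⟧ + ⟦ x ⟧) (<ᵇ-suc b a)) (⟦<ᵇ⟧+⟦≤ᵇ⟧ a b)

module ⋀ = BigOperator Bool.∧-isCommutativeMonoid

allᵇ≡⋀ : (p : B → Bool) (xs : List B) → allᵇ p xs ≡ ⋀.⨁ p xs
allᵇ≡⋀ p []       = refl
allᵇ≡⋀ p (x ∷ xs) = cong (p x ∧_) (allᵇ≡⋀ p xs)

⋀-false : ∀ {p : B → Bool} {x xs} → x ∈ xs → p x ≡ false → ⋀.⨁ p xs ≡ false
⋀-false {p = p} {xs = _ ∷ xs} (here refl) px = cong (_∧ ⋀.⨁ p xs) px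
⋀-false {p = p} (there x∈) px = trans (cong (p _ ∧_) (⋀-false x∈ px)) (Bool.∧-zeroʳ (p _))

column : List ℕ → ℕ → List Box
column κ i = map (i ,_) (range1 (at κ i))

baseRow : List ℕ → List Box
baseRow κ = map (_, 0) (range1 (length κ))

InDiagram : List ℕ → Box → Set
InDiagram κ (i , j) = i ∈[1, length κ ] × j ∈[1, at κ i ]

dg'-bounds : ∀ κ → All (InDiagram κ) (dg' κ)
dg'-bounds κ = All.concat⁺ (All.map⁺ (All.map
  (λ {i} i∈ → All.map⁺ (All.map (i∈ ,_) (range1-bounds (at κ i))))
  (range1-bounds (length κ))))

at-++ˡ : ∀ κ ρ {i} → i ∈[1, length κ ] → at (κ ++ ρ) i ≡ at κ i
at-++ˡ (a ∷ κ) ρ {suc zero}    _              = refl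
at-++ˡ (a ∷ κ) ρ {suc (suc i)} (_ , s≤s i<κ) = at-++ˡ κ ρ (s≤s z≤n , i<κ)

at-∷ʳ-last : ∀ κ b → at (κ ++ [ b ]) (suc (length κ)) ≡ b
at-∷ʳ-last []           b = refl
at-∷ʳ-last (a ∷ [])     b = refl
at-∷ʳ-last (a ∷ a' ∷ κ) b = at-∷ʳ-last (a' ∷ κ) b

⨁-dg' : ∀ κ (f : Box → ℕ) →
        ⨁ f (dg' κ) ≡ ⨁ (λ i → ⨁ (λ j → f (i , j)) (range1 (at κ i))) (range1 (length κ))
⨁-dg' κ f = trans (⨁-concatMap f (column κ) (range1 (length κ)))
  (⨁-cong (λ i → ⨁-map f (i ,_) (range1 (at κ i))) (range1 (length κ)))

⨁-dgHat : ∀ κ (f : Box → ℕ) →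
          ⨁ f (dgHat κ) ≡ ⨁ (λ i → ⨁ (λ j → f (i , j)) (upTo (suc (at κ i)))) (range1 (length κ))
⨁-dgHat κ f = begin
  ⨁ f (dg' κ ++ baseRow κ)                   ≡⟨ ⨁-++ f (dg' κ) (baseRow κ) ⟩
  ⨁ f (dg' κ) + ⨁ f (baseRow κ)              ≡⟨ cong₂ _+_ (⨁-dg' κ f) (⨁-map f (_, 0) cols) ⟩
  ⨁ inColumn cols + ⨁ (λ i → f (i , 0)) cols   ≡⟨ sym (⨁-∙ inColumn (λ i → f (i , 0)) cols) ⟩
  ⨁ (λ i → inColumn i + f (i , 0)) cols        ≡⟨ ⨁-cong (λ i → ℕ.+-comm (inColumn i) (f (i , 0))) cols ⟩
  ⨁ (λ i → f (i , 0) + inColumn i) cols        ≡⟨ ⨁-cong (λ i → cong (⨁ (λ j → f (i , j))) (sym (upTo-suc (at κ i)))) cols ⟩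
  ⨁ (λ i → ⨁ (λ j → f (i , j)) (upTo (suc (at κ i)))) cols ∎
  where
  open ≡-Reasoning
  cols : List ℕ
  cols = range1 (length κ)
  inColumn : ℕ → ℕ
  inColumn i = ⨁ (λ j → f (i , j)) (range1 (at κ i))

∈-dg' : ∀ κ {i j} → i ∈[1, length κ ] → j ∈[1, at κ i ] → (i , j) ∈ dg' κ
∈-dg' κ {i} {j} i∈ j∈ =
  ∈-concatMap⁺ (column κ) (Any.map (λ { refl → ∈-map⁺ (i ,_) (∈-range1 j∈) }) (∈-range1 i∈))

descent : Filling → Box → Bool
descent τ u = hat τ (d u) <ᵇ hat τ u

onDescents : Filling → (Box → ℕ) → Box → ℕ
onDescents τ f u = if descent τ u then f u else 0

⨁-Des : ∀ κ τ (f : Box → ℕ) → ⨁ f (Des κ τ) ≡ ⨁ (onDescents τ f) (dg' κ)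
⨁-Des κ τ f = ⨁-filterᵇ f (descent τ) (dg' κ)

attacksLater : Box → Box → Bool
attacksLater (i , j) (i' , j') = ((j' ≡ᵇ j) ∧ (i' <ᵇ i)) ∨ ((j' + 1 ≡ᵇ j) ∧ (i <ᵇ i'))

-- attacks, precedes and attacksLater see the columns only through these comparisons, so it is
-- enough to compute them for the three Canonical column pairs, by recursion on the rows.
record ColumnOrder (i i' a a' : ℕ) : Set where
  constructor columnOrder
  field
    ≡ᵇ-same : (i ≡ᵇ i') ≡ (a ≡ᵇ a')
    <ᵇ-same : (i <ᵇ i') ≡ (a <ᵇ a')
    >ᵇ-same : (i' <ᵇ i) ≡ (a' <ᵇ a)

data Canonical : ℕ → ℕ → Set where
  left  : Canonical 1 2
  same  : Canonical 1 1
  right : Canonical 2 1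

data ColumnView (i i' : ℕ) : Set where
  view : ∀ {a a'} → Canonical a a' → ColumnOrder i i' a a' → ColumnView i i'

columnView : ∀ i i' → ColumnView i i'
columnView i i' with ℕ.<-cmp i i'
... | tri< i<i' i≢i' _    = view left  (columnOrder (≢⇒≡ᵇ-false i≢i') (<⇒<ᵇ-true i<i') (≤⇒<ᵇ-false (ℕ.<⇒≤ i<i')))
... | tri≈ _ refl _       = view same  (columnOrder (≡ᵇ-refl i) (<ᵇ-irrefl i) (<ᵇ-irrefl i))
... | tri> _ i≢i' i'<i    = view right (columnOrder (≢⇒≡ᵇ-false i≢i') (≤⇒<ᵇ-false (ℕ.<⇒≤ i'<i)) (<⇒<ᵇ-true i'<i))

module _ {i i' a a' : ℕ} where

  attacks-resp : ColumnOrder i i' a a' → ∀ j j' → attacks (i , j) (i' , j') ≡ attacks (a , j) (a' , j')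
  attacks-resp (columnOrder e₁ e₂ e₃) j j' rewrite e₁ | e₂ | e₃ = refl

  precedes-resp : ColumnOrder i i' a a' → ∀ j j' → precedes (i , j) (i' , j') ≡ precedes (a , j) (a' , j')
  precedes-resp (columnOrder _ _ e₃) j j' rewrite e₃ = refl

  attacksLater-resp : ColumnOrder i i' a a' → ∀ j j' →
    attacksLater (i , j) (i' , j') ≡ attacksLater (a , j) (a' , j')
  attacksLater-resp (columnOrder _ e₂ e₃) j j' rewrite e₂ | e₃ = refl

  attacksLater-resp˘ : ColumnOrder i i' a a' → ∀ j j' →
    attacksLater (i' , j') (i , j) ≡ attacksLater (a' , j') (a , j)
  attacksLater-resp˘ (columnOrder _ e₂ e₃) j j' rewrite e₂ | e₃ = refl

attacks∧precedes-canonical : ∀ {a a'} → Canonical a a' → ∀ j j' →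
  attacks (a , j) (a' , j') ∧ precedes (a , j) (a' , j') ≡ attacksLater (a , j) (a' , j')
attacks∧precedes-canonical c     (suc j)       (suc j')       = attacks∧precedes-canonical c j j'
attacks∧precedes-canonical left  zero          zero           = refl
attacks∧precedes-canonical left  zero          (suc zero)     = refl
attacks∧precedes-canonical left  zero          (suc (suc j')) = refl
attacks∧precedes-canonical left  (suc zero)    zero           = refl
attacks∧precedes-canonical left  (suc (suc j)) zero           = refl
attacks∧precedes-canonical same  zero          zero           = refl
attacks∧precedes-canonical same  zero          (suc zero)     = refl
attacks∧precedes-canonical same  zero          (suc (suc j')) = refl
attacks∧precedes-canonical same  (suc zero)    zero           = refl
attacks∧precedes-canonical same  (suc (suc j)) zero           = refl
attacks∧precedes-canonical right zero          zero           = refl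
attacks∧precedes-canonical right zero          (suc zero)     = refl
attacks∧precedes-canonical right zero          (suc (suc j')) = refl
attacks∧precedes-canonical right (suc zero)    zero           = refl
attacks∧precedes-canonical right (suc (suc j)) zero           = refl

attacks-canonical : ∀ {a a'} → Canonical a a' → ∀ j j' →
  attacks (a , j) (a' , j') ≡ attacksLater (a , j) (a' , j') ∨ attacksLater (a' , j') (a , j)
attacks-canonical c     (suc j)       (suc j')       = attacks-canonical c j j'
attacks-canonical left  zero          zero           = refl
attacks-canonical left  zero          (suc zero)     = refl
attacks-canonical left  zero          (suc (suc j')) = refl
attacks-canonical left  (suc zero)    zero           = refl
attacks-canonical left  (suc (suc j)) zero           = refl
attacks-canonical same  zero          zero           = refl
attacks-canonical same  zero          (suc zero)     = refl
attacks-canonical same  zero          (suc (suc j')) = refl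
attacks-canonical same  (suc zero)    zero           = refl
attacks-canonical same  (suc (suc j)) zero           = refl
attacks-canonical right zero          zero           = refl
attacks-canonical right zero          (suc zero)     = refl
attacks-canonical right zero          (suc (suc j')) = refl
attacks-canonical right (suc zero)    zero           = refl
attacks-canonical right (suc (suc j)) zero           = refl

attacks∧precedes≡attacksLater : ∀ u v → attacks u v ∧ precedes u v ≡ attacksLater u v
attacks∧precedes≡attacksLater (i , j) (i' , j') with view c o ← columnView i i' =
  trans (cong₂ _∧_ (attacks-resp o j j') (precedes-resp o j j'))
        (trans (attacks∧precedes-canonical c j j') (sym (attacksLater-resp o j j')))

attacks≡attacksLater : ∀ u v → attacks u v ≡ attacksLater u v ∨ attacksLater v u
attacks≡attacksLater (i , j) (i' , j') with view c o ← columnView i i' =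
  trans (attacks-resp o j j')
        (trans (attacks-canonical c j j') (sym (cong₂ _∨_ (attacksLater-resp o j j') (attacksLater-resp˘ o j j'))))

compatible : Filling → Box → Box → Bool
compatible τ u v = not (attacks u v) ∨ not (hat τ u ≡ᵇ hat τ v)

nonAttacking≡⋀ : ∀ κ τ → nonAttacking κ τ ≡ ⋀.⨁ (λ u → ⋀.⨁ (compatible τ u) (dgHat κ)) (dgHat κ)
nonAttacking≡⋀ κ τ = trans (allᵇ≡⋀ _ (dgHat κ)) (⋀.⨁-cong (λ u → allᵇ≡⋀ (compatible τ u) (dgHat κ)) (dgHat κ))

inversion : Filling → Box → Box → ℕ
inversion τ u v = ⟦ attacksLater u v ∧ (hat τ v <ᵇ hat τ u) ⟧

numInv≡⨁inversion : ∀ κ τ → numInv κ τ ≡ ⨁ (λ u → ⨁ (inversion τ u) (dgHat κ)) (dgHat κ)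
numInv≡⨁inversion κ τ = ⨁-cong (λ u → trans (count≡⨁⟦⟧ _ (dgHat κ)) (⨁-cong (λ v →
  cong ⟦_⟧ (trans (sym (Bool.∧-assoc (attacks u v) (precedes u v) _))
                  (cong (_∧ (hat τ v <ᵇ hat τ u)) (attacks∧precedes≡attacksLater u v)))) (dgHat κ))) (dgHat κ)

later : List ℕ → Box → ℕ
later κ u = ⨁ (λ v → ⟦ attacksLater u v ⟧) (dgHat κ)

earlier : List ℕ → Box → ℕ
earlier κ v = ⨁ (λ u → ⟦ attacksLater u v ⟧) (dgHat κ)

predRows : ℕ → ℕ → ℕ
predRows zero    M = 0
predRows (suc J) M = ⟦ J <ᵇ suc M ⟧

armColumn laterColumn earlierColumn : List ℕ → ℕ → ℕ → ℕ → ℕ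
armColumn κ i J i' =
  (if (i' <ᵇ i) ∧ (at κ i' ≤ᵇ at κ i) then ⟦ J <ᵇ at κ i' ⟧ else 0)
  + (if (i <ᵇ i') ∧ (at κ i' <ᵇ at κ i) then ⟦ J <ᵇ suc (at κ i') ⟧ else 0)
laterColumn κ i J i' =
  (if i' <ᵇ i then ⟦ J <ᵇ suc (at κ i') ⟧ else 0) + (if i <ᵇ i' then predRows J (at κ i') else 0)
earlierColumn κ i J i' =
  (if i <ᵇ i' then ⟦ J <ᵇ suc (at κ i') ⟧ else 0) + (if i' <ᵇ i then ⟦ J <ᵇ at κ i' ⟧ else 0)

⨁-⟦∧⟧ : ∀ (R : B → Bool) b rows → ⨁ (λ k → ⟦ R k ∧ b ⟧) rows ≡ (if b then ⨁ (⟦_⟧ ∘ R) rows else 0)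
⨁-⟦∧⟧ R b rows = trans (⨁-cong (λ k → ⟦∧⟧≡if (R k) b) rows) (⨁-if b (⟦_⟧ ∘ R) rows)

⨁-⟦∨⟧ : ∀ (R S : ℕ → Bool) b c rows → (∀ k → R k ∧ S k ≡ false) →
        ⨁ (λ k → ⟦ (R k ∧ b) ∨ (S k ∧ c) ⟧) rows
        ≡ (if b then ⨁ (⟦_⟧ ∘ R) rows else 0) + (if c then ⨁ (⟦_⟧ ∘ S) rows else 0)
⨁-⟦∨⟧ R S b c rows excl = begin
  ⨁ (λ k → ⟦ (R k ∧ b) ∨ (S k ∧ c) ⟧) rows      ≡⟨ ⨁-cong (λ k → ⟦∨⟧-exclusive (R k) (S k) b c (excl k)) rows ⟩
  ⨁ (λ k → ⟦ R k ∧ b ⟧ + ⟦ S k ∧ c ⟧) rows        ≡⟨ ⨁-∙ (λ k → ⟦ R k ∧ b ⟧) (λ k → ⟦ S k ∧ c ⟧) rows ⟩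
  ⨁ (λ k → ⟦ R k ∧ b ⟧) rows + ⨁ (λ k → ⟦ S k ∧ c ⟧) rows
                                                  ≡⟨ cong₂ _+_ (⨁-⟦∧⟧ R b rows) (⨁-⟦∧⟧ S c rows) ⟩
  (if b then ⨁ (⟦_⟧ ∘ R) rows else 0) + (if c then ⨁ (⟦_⟧ ∘ S) rows else 0) ∎
  where open ≡-Reasoning

≡ᵇ-∧-+1≡ᵇ : ∀ a b → (a ≡ᵇ b) ∧ (a + 1 ≡ᵇ b) ≡ false
≡ᵇ-∧-+1≡ᵇ zero    zero    = refl
≡ᵇ-∧-+1≡ᵇ zero    (suc b) = refl
≡ᵇ-∧-+1≡ᵇ (suc a) zero    = refl
≡ᵇ-∧-+1≡ᵇ (suc a) (suc b) = ≡ᵇ-∧-+1≡ᵇ a b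

#rows-≡ᵇ : ∀ J M → ⨁ (λ k → ⟦ k ≡ᵇ J ⟧) (upTo (suc M)) ≡ ⟦ J <ᵇ suc M ⟧
#rows-≡ᵇ J M = #≡ᵇ-upTo J (suc M)

#rows-+1≡ᵇ : ∀ J M → ⨁ (λ k → ⟦ k + 1 ≡ᵇ J ⟧) (upTo (suc M)) ≡ predRows J M
#rows-+1≡ᵇ J M = trans (⨁-cong (λ k → cong (λ k+1 → ⟦ k+1 ≡ᵇ J ⟧) (ℕ.+-comm k 1)) (upTo (suc M))) (go J)
  where
  go : ∀ J → ⨁ (λ k → ⟦ suc k ≡ᵇ J ⟧) (upTo (suc M)) ≡ predRows J M
  go zero    = ⨁-ε (All.universal (λ _ → refl) (upTo (suc M)))
  go (suc J) = #≡ᵇ-upTo J (suc M)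

arm-by-columns : ∀ κ i J → arm κ (i , suc J) ≡ ⨁ (armColumn κ i J) (range1 (length κ))
arm-by-columns κ i J = begin
  count p (dg' κ) + count r (dgHat κ)
    ≡⟨ cong₂ _+_ (trans (count≡⨁⟦⟧ p (dg' κ)) (⨁-dg' κ (⟦_⟧ ∘ p)))
                 (trans (count≡⨁⟦⟧ r (dgHat κ)) (⨁-dgHat κ (⟦_⟧ ∘ r))) ⟩
  ⨁ (λ i' → ⨁ (λ j → ⟦ p (i' , j) ⟧) (range1 (at κ i'))) cols
    + ⨁ (λ i' → ⨁ (λ j → ⟦ r (i' , j) ⟧) (upTo (suc (at κ i')))) cols
    ≡⟨ sym (⨁-∙ (λ i' → ⨁ (λ j → ⟦ p (i' , j) ⟧) (range1 (at κ i')))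
                (λ i' → ⨁ (λ j → ⟦ r (i' , j) ⟧) (upTo (suc (at κ i')))) cols) ⟩
  ⨁ (λ i' → ⨁ (λ j → ⟦ p (i' , j) ⟧) (range1 (at κ i')) + ⨁ (λ j → ⟦ r (i' , j) ⟧) (upTo (suc (at κ i')))) cols
    ≡⟨ ⨁-cong (λ i' → cong₂ _+_ (dg'-rows i') (dgHat-rows i')) cols ⟩
  ⨁ (armColumn κ i J) cols ∎
  where
  open ≡-Reasoning
  cols : List ℕ
  cols = range1 (length κ)
  p r : Box → Bool
  p (i' , j) = (j ≡ᵇ suc J) ∧ (i' <ᵇ i) ∧ (at κ i' ≤ᵇ at κ i)
  r (i' , j) = (j + 1 ≡ᵇ suc J) ∧ (i <ᵇ i') ∧ (at κ i' <ᵇ at κ i)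
  dg'-rows : ∀ i' → ⨁ (λ j → ⟦ p (i' , j) ⟧) (range1 (at κ i'))
                    ≡ (if (i' <ᵇ i) ∧ (at κ i' ≤ᵇ at κ i) then ⟦ J <ᵇ at κ i' ⟧ else 0)
  dg'-rows i' = trans (⨁-⟦∧⟧ (_≡ᵇ suc J) _ (range1 (at κ i')))
    (cong (λ x → if (i' <ᵇ i) ∧ (at κ i' ≤ᵇ at κ i) then x else 0)
          (trans (⨁-map (λ j → ⟦ j ≡ᵇ suc J ⟧) suc (upTo (at κ i'))) (#≡ᵇ-upTo J (at κ i'))))
  dgHat-rows : ∀ i' → ⨁ (λ j → ⟦ r (i' , j) ⟧) (upTo (suc (at κ i')))
                      ≡ (if (i <ᵇ i') ∧ (at κ i' <ᵇ at κ i) then ⟦ J <ᵇ suc (at κ i') ⟧ else 0)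
  dgHat-rows i' = trans (⨁-⟦∧⟧ (λ j → j + 1 ≡ᵇ suc J) _ (upTo (suc (at κ i'))))
    (cong (λ x → if (i <ᵇ i') ∧ (at κ i' <ᵇ at κ i) then x else 0) (#rows-+1≡ᵇ (suc J) (at κ i')))

later-by-columns : ∀ κ i J → later κ (i , J) ≡ ⨁ (laterColumn κ i J) (range1 (length κ))
later-by-columns κ i J = trans (⨁-dgHat κ _) (⨁-cong in-column (range1 (length κ)))
  where
  in-column : ∀ i' → ⨁ (λ j → ⟦ attacksLater (i , J) (i' , j) ⟧) (upTo (suc (at κ i'))) ≡ laterColumn κ i J i'
  in-column i' =
    trans (⨁-⟦∨⟧ (_≡ᵇ J) (λ k → k + 1 ≡ᵇ J) (i' <ᵇ i) (i <ᵇ i') (upTo (suc (at κ i'))) (λ k → ≡ᵇ-∧-+1≡ᵇ k J))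
          (cong₂ (λ x y → (if i' <ᵇ i then x else 0) + (if i <ᵇ i' then y else 0))
                 (#rows-≡ᵇ J (at κ i')) (#rows-+1≡ᵇ J (at κ i')))

earlier-by-columns : ∀ κ i J → earlier κ (i , J) ≡ ⨁ (earlierColumn κ i J) (range1 (length κ))
earlier-by-columns κ i J = trans (⨁-dgHat κ _) (⨁-cong in-column (range1 (length κ)))
  where
  in-column : ∀ i' → ⨁ (λ j → ⟦ attacksLater (i' , j) (i , J) ⟧) (upTo (suc (at κ i'))) ≡ earlierColumn κ i J i'
  in-column i' =
    trans (⨁-⟦∨⟧ (J ≡ᵇ_) (J + 1 ≡ᵇ_) (i <ᵇ i') (i' <ᵇ i) (upTo (suc (at κ i'))) (≡ᵇ-∧-+1≡ᵇ J))
          (cong₂ (λ x y → (if i <ᵇ i' then x else 0) + (if i' <ᵇ i then y else 0))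
                 (trans (⨁-cong (λ k → cong ⟦_⟧ (≡ᵇ-sym J k)) (upTo (suc (at κ i')))) (#rows-≡ᵇ J (at κ i')))
                 (trans (⨁-cong (λ k → cong ⟦_⟧ (trans (≡ᵇ-sym (J + 1) k) (cong (k ≡ᵇ_) (ℕ.+-comm J 1))))
                                (upTo (suc (at κ i'))))
                        (#rows-≡ᵇ (suc J) (at κ i'))))

arm-top : ∀ κ i → arm κ (i , suc (at κ i)) ≡ 0
arm-top κ i = trans (arm-by-columns κ i (at κ i)) (⨁-ε (All.universal column-empty (range1 (length κ))))
  where
  column-empty : ∀ i' → armColumn κ i (at κ i) i' ≡ 0
  column-empty i' = cong₂ _+_
    (if-∧-zero (i' <ᵇ i) (at κ i' ≤ᵇ at κ i) (λ e → cong ⟦_⟧ (≤⇒<ᵇ-false (≤ᵇ-true⇒≤ (at κ i') (at κ i) e))))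
    (if-∧-zero (i <ᵇ i') (at κ i' <ᵇ at κ i) (λ e → cong ⟦_⟧ (≤⇒<ᵇ-false (<ᵇ-true⇒< (at κ i') (at κ i) e))))

-- By +-swap-unless: when the comparison of the column heights fails, the two row counts being
-- exchanged are both 1.
later+arm-above≡earlier+arm-column : ∀ κ i J → suc J ≤ at κ i → ∀ i' →
  laterColumn κ i (suc J) i' + armColumn κ i (suc J) i' ≡ earlierColumn κ i (suc J) i' + armColumn κ i J i'
later+arm-above≡earlier+arm-column κ i J J<N i' with ℕ.<-cmp i' i
... | tri< i'<i _ _ rewrite <⇒<ᵇ-true i'<i | ≤⇒<ᵇ-false (ℕ.<⇒≤ i'<i) =
  trans (cong₂ _+_ (ℕ.+-identityʳ ⟦ J <ᵇ M ⟧) (ℕ.+-identityʳ (if M ≤ᵇ N then ⟦ suc J <ᵇ M ⟧ else 0)))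
        (trans (+-swap-unless (M ≤ᵇ N) ⟦ J <ᵇ M ⟧ ⟦ suc J <ᵇ M ⟧ both-one)
               (cong (⟦ suc J <ᵇ M ⟧ +_) (sym (ℕ.+-identityʳ (if M ≤ᵇ N then ⟦ J <ᵇ M ⟧ else 0)))))
  where
  M N : ℕ
  M = at κ i'
  N = at κ i
  both-one : (M ≤ᵇ N) ≡ false → ⟦ J <ᵇ M ⟧ ≡ ⟦ suc J <ᵇ M ⟧
  both-one e = let J<M = ℕ.≤-<-trans J<N (≤ᵇ-false⇒> M N e) in
    trans (cong ⟦_⟧ (<⇒<ᵇ-true (ℕ.<-trans (ℕ.n<1+n J) J<M))) (sym (cong ⟦_⟧ (<⇒<ᵇ-true J<M)))
... | tri≈ _ refl _ rewrite <ᵇ-irrefl i = refl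
... | tri> _ _ i<i' rewrite <⇒<ᵇ-true i<i' | ≤⇒<ᵇ-false (ℕ.<⇒≤ i<i') =
  trans (+-swap-unless (M <ᵇ N) ⟦ J <ᵇ suc M ⟧ ⟦ J <ᵇ M ⟧ both-one)
        (cong (_+ (if M <ᵇ N then ⟦ J <ᵇ suc M ⟧ else 0)) (sym (ℕ.+-identityʳ ⟦ J <ᵇ M ⟧)))
  where
  M N : ℕ
  M = at κ i'
  N = at κ i
  both-one : (M <ᵇ N) ≡ false → ⟦ J <ᵇ suc M ⟧ ≡ ⟦ J <ᵇ M ⟧
  both-one e = let J<M = ℕ.<-≤-trans J<N (<ᵇ-false⇒≥ M N e) in
    trans (cong ⟦_⟧ (<⇒<ᵇ-true (ℕ.m<n⇒m<1+n J<M))) (sym (cong ⟦_⟧ (<⇒<ᵇ-true J<M)))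

later+arm-above≡earlier+arm : ∀ κ i J → suc J ≤ at κ i →
  later κ (i , suc J) + arm κ (i , suc (suc J)) ≡ earlier κ (i , suc J) + arm κ (i , suc J)
later+arm-above≡earlier+arm κ i J J<N = begin
  later κ (i , suc J) + arm κ (i , suc (suc J))
    ≡⟨ cong₂ _+_ (later-by-columns κ i (suc J)) (arm-by-columns κ i (suc J)) ⟩
  ⨁ (laterColumn κ i (suc J)) cols + ⨁ (armColumn κ i (suc J)) cols
    ≡⟨ sym (⨁-∙ (laterColumn κ i (suc J)) (armColumn κ i (suc J)) cols) ⟩
  ⨁ (λ i' → laterColumn κ i (suc J) i' + armColumn κ i (suc J) i') cols
    ≡⟨ ⨁-cong (later+arm-above≡earlier+arm-column κ i J J<N) cols ⟩
  ⨁ (λ i' → earlierColumn κ i (suc J) i' + armColumn κ i J i') cols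
    ≡⟨ ⨁-∙ (earlierColumn κ i (suc J)) (armColumn κ i J) cols ⟩
  ⨁ (earlierColumn κ i (suc J)) cols + ⨁ (armColumn κ i J) cols
    ≡⟨ sym (cong₂ _+_ (earlier-by-columns κ i (suc J)) (arm-by-columns κ i J)) ⟩
  earlier κ (i , suc J) + arm κ (i , suc J) ∎
  where
  open ≡-Reasoning
  cols : List ℕ
  cols = range1 (length κ)

later+arm-above≡earlier+#lower : ∀ κ i → length κ ≤ i →
  later κ (i , 0) + arm κ (i , 1)
  ≡ earlier κ (i , 0) + ⨁ (λ i' → ⟦ (i' <ᵇ i) ∧ (at κ i' ≤ᵇ at κ i) ⟧) (range1 (length κ))
later+arm-above≡earlier+#lower κ i n≤i = begin
  later κ (i , 0) + arm κ (i , 1)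
    ≡⟨ cong₂ _+_ (later-by-columns κ i 0) (arm-by-columns κ i 0) ⟩
  ⨁ (laterColumn κ i 0) cols + ⨁ (armColumn κ i 0) cols
    ≡⟨ sym (⨁-∙ (laterColumn κ i 0) (armColumn κ i 0) cols) ⟩
  ⨁ (λ i' → laterColumn κ i 0 i' + armColumn κ i 0 i') cols
    ≡⟨ ⨁-cong-local (All.map (λ {i'} (_ , i'≤n) → balance i' (ℕ.≤-trans i'≤n n≤i)) (range1-bounds (length κ))) ⟩
  ⨁ (λ i' → earlierColumn κ i 0 i' + lower i') cols
    ≡⟨ ⨁-∙ (earlierColumn κ i 0) lower cols ⟩
  ⨁ (earlierColumn κ i 0) cols + ⨁ lower cols
    ≡⟨ cong (_+ ⨁ lower cols) (sym (earlier-by-columns κ i 0)) ⟩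
  earlier κ (i , 0) + ⨁ lower cols ∎
  where
  open ≡-Reasoning
  cols : List ℕ
  cols = range1 (length κ)
  lower : ℕ → ℕ
  lower i' = ⟦ (i' <ᵇ i) ∧ (at κ i' ≤ᵇ at κ i) ⟧
  base-column : ∀ P M N →
    ((if P then 1 else 0) + 0) + ((if P ∧ (M ≤ᵇ N) then ⟦ 0 <ᵇ M ⟧ else 0) + 0)
    ≡ (if P then ⟦ 0 <ᵇ M ⟧ else 0) + ⟦ P ∧ (M ≤ᵇ N) ⟧
  base-column false M       N = refl
  base-column true  zero    N = refl
  base-column true  (suc M) N with M <ᵇ N
  ... | true  = refl
  ... | false = refl
  balance : ∀ i' → i' ≤ i → laterColumn κ i 0 i' + armColumn κ i 0 i' ≡ earlierColumn κ i 0 i' + lower i'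
  balance i' i'≤i rewrite ≤⇒<ᵇ-false i'≤i = base-column (i' <ᵇ i) (at κ i') (at κ i)

column-telescope : ∀ M (a : ℕ → ℕ) →
  ⨁ (λ j → a (j ∸ 1) ℕ.* suc (M ∸ j)) (range1 M) + ⨁ a (range1 M)
  ≡ ⨁ (λ j → a j ℕ.* suc (M ∸ j)) (range1 M) + M ℕ.* a 0
column-telescope zero    a = refl
column-telescope (suc M) a = begin
  ⨁ (λ j → a (j ∸ 1) ℕ.* suc (suc M ∸ j)) (range1 (suc M)) + ⨁ a (range1 (suc M))
    ≡⟨ cong₂ _+_ (split (λ j → a (j ∸ 1) ℕ.* suc (suc M ∸ j))) (split a) ⟩
  (a 0 ℕ.* suc M + U) + (a 1 + V)      ≡⟨ rearrange₁ (a 0) M U (a 1) V ⟩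
  a 0 ℕ.* suc M + a 1 + (U + V)        ≡⟨ cong (a 0 ℕ.* suc M + a 1 +_) (trans (cong (_+ V) (sym U-shift)) (column-telescope M (a ∘ suc))) ⟩
  a 0 ℕ.* suc M + a 1 + (U' + M ℕ.* a 1) ≡⟨ rearrange₂ (a 0) M (a 1) U' ⟩
  (a 1 ℕ.* suc M + U') + suc M ℕ.* a 0   ≡⟨ cong (_+ suc M ℕ.* a 0) (sym (split (λ j → a j ℕ.* suc (suc M ∸ j)))) ⟩
  ⨁ (λ j → a j ℕ.* suc (suc M ∸ j)) (range1 (suc M)) + suc M ℕ.* a 0 ∎
  where
  open ≡-Reasoning
  U U' V : ℕ
  U  = ⨁ (λ j → a j ℕ.* suc (M ∸ j)) (range1 M)
  U' = ⨁ (λ j → a (suc j) ℕ.* suc (M ∸ j)) (range1 M)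
  V  = ⨁ (a ∘ suc) (range1 M)
  split : ∀ f → ⨁ f (range1 (suc M)) ≡ f 1 + ⨁ (f ∘ suc) (range1 M)
  split f = trans (cong (⨁ f) (range1-suc M)) (cong (f 1 +_) (⨁-map f suc (range1 M)))
  U-shift : ⨁ (λ j → a (suc (j ∸ 1)) ℕ.* suc (M ∸ j)) (range1 M) ≡ U
  U-shift = ⨁-cong-local (All.map (λ { {suc j} _ → refl }) (range1-bounds M))
  rearrange₁ : ∀ x M U y V → (x ℕ.* suc M + U) + (y + V) ≡ x ℕ.* suc M + y + (U + V)
  rearrange₁ = solve-∀
  rearrange₂ : ∀ x M y U → x ℕ.* suc M + y + (U + M ℕ.* y) ≡ (y ℕ.* suc M + U) + suc M ℕ.* x
  rearrange₂ = solve-∀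

sub-eq : ∀ a b {c} → a + b ≡ c → ℤ.+ a ≡ ℤ.+ c ℤ.- ℤ.+ b
sub-eq a b refl = cancel (ℤ.+ a) (ℤ.+ b)
  where
  cancel : ∀ x y → x ≡ (x ℤ.+ y) ℤ.- y
  cancel = ℤSolver.solve-∀

-- The relations proved below between the statistics of a filling σ and of its rotation σ', combined.
coinv-balance : ∀ {arms arms' inv inv' pairs pairs' desc desc' within low m later earlier atN belowN : ℕ} →
  arms' ≡ low + arms → pairs' + low ≡ within + m → pairs ≡ within + low →
  inv' + later ≡ m + (inv + earlier) → desc' + atN ≡ desc + belowN → later + belowN ≡ earlier + (atN + low) →
  ℤ.+ arms' ℤ.- (ℤ.+ inv' ℤ.- ℤ.+ pairs' ℤ.- ℤ.+ desc') ≡ ℤ.+ arms ℤ.- (ℤ.+ inv ℤ.- ℤ.+ pairs ℤ.- ℤ.+ desc)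
coinv-balance {arms} {_} {inv} {inv'} {_} {pairs'} {desc} {desc'} {within} {low} {m} {later} {earlier} {atN} {belowN}
              refl pairs'+low refl inv'+later desc'+atN later+belowN =
  trans (cong₂ (λ x y → ℤ.+ (low + arms) ℤ.- (x ℤ.- y))
               (cong₂ ℤ._-_ (trans (sub-eq inv' later inv'+later)
                                   (cong (λ x → ℤ.+ (m + (inv + earlier)) ℤ.- x) (sub-eq later belowN later+belowN)))
                            (sub-eq pairs' low pairs'+low))
               (sub-eq desc' atN desc'+atN))
        (identity (ℤ.+ arms) (ℤ.+ low) (ℤ.+ m) (ℤ.+ inv) (ℤ.+ earlier) (ℤ.+ within) (ℤ.+ desc) (ℤ.+ belowN) (ℤ.+ atN))
  where
  open ℤ using () renaming (_+_ to _⊕_; _-_ to _⊝_)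
  identity : ∀ A L m I E W D B N →
    (L ⊕ A) ⊝ (((m ⊕ (I ⊕ E)) ⊝ ((E ⊕ (N ⊕ L)) ⊝ B) ⊝ ((W ⊕ m) ⊝ L)) ⊝ ((D ⊕ B) ⊝ N)) ≡ A ⊝ (I ⊝ (W ⊕ L) ⊝ D)
  identity = ℤSolver.solve-∀

eqBox-refl : ∀ u → eqBox u u ≡ true
eqBox-refl (i , j) rewrite ≡ᵇ-refl i | ≡ᵇ-refl j = refl

eqBox-sym : ∀ u v → eqBox u v ≡ eqBox v u
eqBox-sym (i , j) (i' , j') rewrite ≡ᵇ-sym i i' | ≡ᵇ-sym j j' = refl

eqBox-true⇒≡ : ∀ u v → eqBox u v ≡ true → u ≡ v
eqBox-true⇒≡ (i , j) (i' , j') e with i ≡ᵇ i' in e₁ | j ≡ᵇ j' in e₂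
... | true | true = cong₂ _,_ (ℕ.≡ᵇ⇒≡ i i' (subst T (sym e₁) _)) (ℕ.≡ᵇ⇒≡ j j' (subst T (sym e₂) _))

Keys-disjoint : Filling → Filling → Set
Keys-disjoint τ₁ τ₂ = All (λ (u , _) → All (λ (v , _) → eqBox u v ≡ false) τ₂) τ₁

lookupF-insert : ∀ τ₁ (x : Box × ℕ) τ₂ u → All (λ (v , _) → eqBox (proj₁ x) v ≡ false) τ₁ →
  lookupF (τ₁ ++ x ∷ τ₂) u ≡ (if eqBox u (proj₁ x) then proj₂ x else lookupF (τ₁ ++ τ₂) u)
lookupF-insert []             x        τ₂ u []         = refl
lookupF-insert ((v , a) ∷ τ₁) (w , b) τ₂ u (w≢v ∷ ws) with eqBox u v in u≡v
... | false = lookupF-insert τ₁ (w , b) τ₂ u ws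
... | true = cong (λ z → if z then b else a) (sym u≢w)
  where
  u≢w : eqBox u w ≡ false
  u≢w = trans (cong (λ z → eqBox z w) (eqBox-true⇒≡ u v u≡v)) (trans (eqBox-sym v w) w≢v)

lookupF-swap : ∀ τ₁ τ₂ u → Keys-disjoint τ₁ τ₂ → lookupF (τ₁ ++ τ₂) u ≡ lookupF (τ₂ ++ τ₁) u
lookupF-swap []            τ₂ u _          rewrite List.++-identityʳ τ₂ = refl
lookupF-swap ((v , a) ∷ τ₁) τ₂ u (v∉ ∷ vs) rewrite lookupF-insert τ₂ (v , a) τ₁ u v∉ | lookupF-swap τ₁ τ₂ u vs = refl

lookupF-map : ∀ (f : Box → Box) (g : ℕ → ℕ) τ u → g 0 ≡ 0 →
  All (λ (v , _) → eqBox (f u) (f v) ≡ eqBox u v) τ →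
  lookupF (map (Product.map f g) τ) (f u) ≡ g (lookupF τ u)
lookupF-map f g []             u g0 []          = sym g0
lookupF-map f g ((v , a) ∷ τ) u g0 (e ∷ es) rewrite e with eqBox u v
... | true  = refl
... | false = lookupF-map f g τ u g0 es

zip-++ : ∀ (xs ys : List B) (as bs : List D) → length xs ≡ length as →
         zip (xs ++ ys) (as ++ bs) ≡ zip xs as ++ zip ys bs
zip-++ []       ys []       bs _ = refl
zip-++ (x ∷ xs) ys (a ∷ as) bs e = cong ((x , a) ∷_) (zip-++ xs ys as bs (ℕ.suc-injective e))

All-zip-keys : ∀ {P : B → Set} {xs : List B} (ys : List D) → All P xs → All (P ∘ proj₁) (zip xs ys)
All-zip-keys ys       []         = []
All-zip-keys []       (px ∷ pxs) = []
All-zip-keys (y ∷ ys) (px ∷ pxs) = px ∷ All-zip-keys ys pxs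

lookupF-zip-All : ∀ {P : ℕ → Set} (L : List Box) (w : List ℕ) → length L ≡ length w → All P w →
  All (λ u → P (lookupF (zip L w) u)) L
lookupF-zip-All []      w       _ _          = []
lookupF-zip-All {P} (v ∷ L) (a ∷ w) e (pa ∷ pw) =
  first ∷ All.map step (lookupF-zip-All L w (ℕ.suc-injective e) pw)
  where
  first : P (if eqBox v v then a else lookupF (zip L w) v)
  first rewrite eqBox-refl v = pa
  step : ∀ {u} → P (lookupF (zip L w) u) → P (if eqBox u v then a else lookupF (zip L w) u)
  step {u} p with eqBox u v
  ... | true  = pa
  ... | false = p

module ∏ℚ = BigOperator ℚ.*-1-isCommutativeMonoid
module ∑ℚ = BigOperator ℚ.+-0-isCommutativeMonoid

xAt-++ˡ : ∀ xs ys {k} → k ∈[1, length xs ] → xAt (xs ++ ys) k ≡ xAt xs k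
xAt-++ˡ (a ∷ xs) ys {suc zero}    _              = refl
xAt-++ˡ (a ∷ xs) ys {suc (suc k)} (_ , s≤s k<xs) = xAt-++ˡ xs ys (s≤s z≤n , k<xs)

xAt-∷ʳ-last : ∀ xs y → xAt (xs ++ [ y ]) (suc (length xs)) ≡ y
xAt-∷ʳ-last []           y = refl
xAt-∷ʳ-last (a ∷ [])     y = refl
xAt-∷ʳ-last (a ∷ a' ∷ xs) y = xAt-∷ʳ-last (a' ∷ xs) y

∏-if≡^count : (p : B → Bool) (r : ℚ) (xs : List B) → ∏ℚ.⨁ (λ x → if p x then r else 1ℚ) xs ≡ r ^ count p xs
∏-if≡^count p r []       = refl
∏-if≡^count p r (x ∷ xs) with p x
... | true  = cong (r *_) (∏-if≡^count p r xs)
... | false = trans (ℚ.*-identityˡ _) (∏-if≡^count p r xs)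

^-+ : ∀ p a b → p ^ (a + b) ≡ p ^ a * p ^ b
^-+ p zero    b = sym (ℚ.*-identityˡ _)
^-+ p (suc a) b = trans (cong (p *_) (^-+ p a b)) (sym (ℚ.*-assoc p _ _))

inv-*ˡ : ∀ {q} → q ≢ 0ℚ → inv q * q ≡ 1ℚ
inv-*ˡ {q} q≢0 with q ℚ.≟ 0ℚ
... | yes q≡0 = ⊥-elim (q≢0 q≡0)
... | no  q≢0' = ℚ.*-inverseˡ q {{ℚ.≢-nonZero q≢0'}}

inv^*^ : ∀ {q} → q ≢ 0ℚ → ∀ k → inv q ^ k * q ^ k ≡ 1ℚ
inv^*^ q≢0 zero    = refl
inv^*^ {q} q≢0 (suc k) = trans (interchange (inv q) (inv q ^ k) q (q ^ k))
  (cong₂ _*_ (inv-*ˡ q≢0) (inv^*^ q≢0 k))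
  where
  open +-*-Solver
  interchange : ∀ a b c d → (a * b) * (c * d) ≡ (a * c) * (b * d)
  interchange = solve 4 (λ a b c d → (a :* b) :* (c :* d) := (a :* c) :* (b :* d)) refl

^-shift : ∀ {q} → q ≢ 0ℚ → ∀ M' k M c → M' + k ≡ M + c → q ^ M' ≡ q ^ c * (inv q ^ k * q ^ M)
^-shift {q} q≢0 M' k M c e = begin
  q ^ M'                               ≡⟨ sym (ℚ.*-identityʳ _) ⟩
  q ^ M' * 1ℚ                        ≡⟨ cong (q ^ M' *_) (sym (trans (ℚ.*-comm (q ^ k) _) (inv^*^ q≢0 k))) ⟩
  q ^ M' * (q ^ k * inv q ^ k)     ≡⟨ sym (ℚ.*-assoc (q ^ M') _ _) ⟩
  (q ^ M' * q ^ k) * inv q ^ k     ≡⟨ cong (_* inv q ^ k) (trans (sym (^-+ q M' k)) (trans (cong (q ^_) e) (^-+ q M c))) ⟩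
  (q ^ M * q ^ c) * inv q ^ k      ≡⟨ rearrange (q ^ M) (q ^ c) (inv q ^ k) ⟩
  q ^ c * (inv q ^ k * q ^ M)      ∎
  where
  open ≡-Reasoning
  open +-*-Solver
  rearrange : ∀ a b c → (a * b) * c ≡ b * (c * a)
  rearrange = solve 3 (λ a b c → (a :* b) :* c := b :* (c :* a)) refl

words-length : ∀ n k → All (λ w → length w ≡ k) (words n k)
words-length n zero    = refl ∷ []
words-length n (suc k) =
  All.concat⁺ (All.map⁺ (All.universal (λ _ → All.map⁺ (All.map (cong suc) (words-length n k))) (range1 n)))

words-range : ∀ n k → All (All (_∈[1, n ])) (words n k)
words-range n zero    = [] ∷ []
words-range n (suc k) =
  All.concat⁺ (All.map⁺ (All.map (λ a∈ → All.map⁺ (All.map (a∈ ∷_) (words-range n k))) (range1-bounds n)))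

weight : List ℕ → List ℚ → ℚ → ℚ → List ℕ → ℚ
weight κ x q t w = if nonAttacking κ (zip (dg' κ) w) then term κ x q t (zip (dg' κ) w) else 0ℚ

Cℓ≡⨁weight : ∀ κ x q t → Cℓ κ x q t ≡ ∑ℚ.⨁ (weight κ x q t) (words (length κ) (length (dg' κ)))
Cℓ≡⨁weight κ x q t = trans (∑ℚ.⨁-filterᵇ (term κ x q t) (nonAttacking κ) (fillings κ))
  (∑ℚ.⨁-map (λ σ → if nonAttacking κ σ then term κ x q t σ else 0ℚ) (zip (dg' κ)) (words (length κ) (length (dg' κ))))

-- μ' is π μ of the paper.
module Rotation (ν : List ℕ) (c : ℕ) where

  m n : ℕ
  m = length ν
  n = suc m

  μ μ' : List ℕ
  μ  = ν ++ [ c ]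
  μ' = suc c ∷ ν

  length-μ : length μ ≡ n
  length-μ = trans (List.length-++ ν) (ℕ.+-comm m 1)

  at-μ-last : at μ n ≡ c
  at-μ-last = at-∷ʳ-last ν c

  at-μ'-suc : ∀ {i} → i ∈[1, m ] → at μ' (suc i) ≡ at μ i
  at-μ'-suc {suc i} i∈ = sym (at-++ˡ ν [ c ] i∈)

  data ColumnOf : ℕ → Set where
    rightmost : ColumnOf n
    inner     : ∀ {i} → i ≤ m → ColumnOf i

  columnOf : ∀ {i} → i ≤ n → ColumnOf i
  columnOf i≤n with ℕ.m≤n⇒m<n∨m≡n i≤n
  ... | inj₁ (s≤s i≤m) = inner i≤m
  ... | inj₂ refl      = rightmost

  inner≢last : ∀ {i} → i ≤ m → i ≢ n
  inner≢last i≤m refl = ℕ.<-irrefl refl (s≤s i≤m)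

  inner-≡ᵇ-last : ∀ {i} → i ≤ m → (i ≡ᵇ n) ≡ false
  inner-≡ᵇ-last i≤m = ≢⇒≡ᵇ-false (inner≢last i≤m)

  rotate : Box → Box
  rotate (i , j) = if i ≡ᵇ n then (1 , suc j) else (suc i , j)

  -- cycle 0 = 0 keeps the value 0 of a failed lookupF fixed.
  cycle : ℕ → ℕ
  cycle zero    = zero
  cycle (suc k) = if suc k ≡ᵇ n then 1 else suc (suc k)

  rotate-last : ∀ j → rotate (n , j) ≡ (1 , suc j)
  rotate-last j rewrite ≡ᵇ-refl n = refl

  rotate-inner : ∀ {i} j → i ≤ m → rotate (i , j) ≡ (suc i , j)
  rotate-inner j i≤m rewrite inner-≡ᵇ-last i≤m = refl

  cycle-last : cycle n ≡ 1
  cycle-last rewrite ≡ᵇ-refl n = refl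

  cycle-inner : ∀ {k} → k ∈[1, m ] → cycle k ≡ suc k
  cycle-inner {suc k} (_ , k≤m) rewrite inner-≡ᵇ-last k≤m = refl

  innerColumns lastColumn innerBase : List Box
  innerColumns = concatMap (column μ) (range1 m)
  lastColumn   = map (n ,_) (range1 c)
  innerBase    = map (_, 0) (range1 m)

  dg'-μ : dg' μ ≡ innerColumns ++ lastColumn
  dg'-μ = begin
    concatMap (column μ) (range1 (length μ))      ≡⟨ cong (λ k → concatMap (column μ) (range1 k)) length-μ ⟩
    concatMap (column μ) (range1 n)               ≡⟨ cong (concatMap (column μ)) (range1-∷ʳ m) ⟩
    concatMap (column μ) (range1 m ++ [ n ])      ≡⟨ List.concatMap-++ (column μ) (range1 m) [ n ] ⟩
    innerColumns ++ (column μ n ++ [])            ≡⟨ cong (innerColumns ++_) (List.++-identityʳ (column μ n)) ⟩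
    innerColumns ++ column μ n                    ≡⟨ cong (λ k → innerColumns ++ map (n ,_) (range1 k)) at-μ-last ⟩
    innerColumns ++ lastColumn                    ∎
    where open ≡-Reasoning

  dg'-μ' : dg' μ' ≡ (1 , 1) ∷ (map rotate lastColumn ++ map rotate innerColumns)
  dg'-μ' = begin
    concatMap (column μ') (range1 n)
      ≡⟨ cong (concatMap (column μ')) (range1-suc m) ⟩
    column μ' 1 ++ concatMap (column μ') (map suc (range1 m))
      ≡⟨ cong₂ _++_ first-column (List.concatMap-map (column μ') suc (range1 m)) ⟩
    ((1 , 1) ∷ map (λ j → (1 , suc j)) (range1 c)) ++ concatMap (column μ' ∘ suc) (range1 m)
      ≡⟨ cong₂ (λ a b → (1 , 1) ∷ (a ++ b)) (sym rotate-lastColumn) (sym rotate-innerColumns) ⟩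
    (1 , 1) ∷ (map rotate lastColumn ++ map rotate innerColumns) ∎
    where
    open ≡-Reasoning
    first-column : column μ' 1 ≡ (1 , 1) ∷ map (λ j → (1 , suc j)) (range1 c)
    first-column = trans (cong (map (1 ,_)) (range1-suc c)) (cong ((1 , 1) ∷_) (sym (List.map-∘ (range1 c))))
    rotate-lastColumn : map rotate lastColumn ≡ map (λ j → (1 , suc j)) (range1 c)
    rotate-lastColumn = trans (sym (List.map-∘ (range1 c))) (List.map-cong rotate-last (range1 c))
    rotate-column : ∀ {i} → i ∈[1, m ] → map rotate (column μ i) ≡ column μ' (suc i)
    rotate-column {i} i∈@(_ , i≤m) = begin
      map rotate (map (i ,_) (range1 (at μ i)))  ≡⟨ sym (List.map-∘ (range1 (at μ i))) ⟩
      map (rotate ∘ (i ,_)) (range1 (at μ i))   ≡⟨ List.map-cong (λ j → rotate-inner j i≤m) (range1 (at μ i)) ⟩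
      map (suc i ,_) (range1 (at μ i))          ≡⟨ cong (λ k → map (suc i ,_) (range1 k)) (sym (at-μ'-suc i∈)) ⟩
      column μ' (suc i)                         ∎
    rotate-innerColumns : map rotate innerColumns ≡ concatMap (column μ' ∘ suc) (range1 m)
    rotate-innerColumns = trans (List.map-concatMap rotate (column μ) (range1 m))
      (cong concat (List.map-cong-local (All.map rotate-column (range1-bounds m))))

  baseRow-μ : baseRow μ ≡ innerBase ++ [ (n , 0) ]
  baseRow-μ = trans (cong (λ k → map (_, 0) (range1 k)) length-μ)
                    (trans (cong (map (_, 0)) (range1-∷ʳ m)) (List.map-++ (_, 0) (range1 m) [ n ]))

  baseRow-μ' : baseRow μ' ≡ (1 , 0) ∷ map rotate innerBase
  baseRow-μ' = trans (cong (map (_, 0)) (range1-suc m)) (cong ((1 , 0) ∷_) (begin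
    map (_, 0) (map suc (range1 m))   ≡⟨ sym (List.map-∘ (range1 m)) ⟩
    map (λ i → (suc i , 0)) (range1 m) ≡⟨ sym (List.map-cong-local (All.map (λ (_ , i≤m) → rotate-inner 0 i≤m) (range1-bounds m))) ⟩
    map (rotate ∘ (_, 0)) (range1 m)   ≡⟨ List.map-∘ (range1 m) ⟩
    map rotate innerBase               ∎))
    where open ≡-Reasoning

  dg'-μ'-↭ : dg' μ' ↭ (1 , 1) ∷ map rotate (dg' μ)
  dg'-μ'-↭ = ↭-trans (↭-reflexive dg'-μ') (prep (1 , 1)
    (↭-trans (↭.++-comm (map rotate lastColumn) (map rotate innerColumns))
             (↭-reflexive (sym (trans (cong (map rotate) dg'-μ) (List.map-++ rotate innerColumns lastColumn))))))

  dgHat-μ'-↭ : dgHat μ' ↭ (1 , 0) ∷ map rotate (dgHat μ)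
  dgHat-μ'-↭ = ↭-trans (↭.++⁺ dg'-μ'-↭ (↭-reflexive baseRow-μ'))
    (↭-trans (∷-++-∷-↭ (1 , 1) (1 , 0) (map rotate (dg' μ)) (map rotate innerBase))
             (↭-reflexive (cong ((1 , 0) ∷_) (sym rotate-dgHat))))
    where
    rotate-dgHat : map rotate (dgHat μ) ≡ map rotate (dg' μ) ++ (map rotate innerBase ++ [ (1 , 1) ])
    rotate-dgHat = begin
      map rotate (dg' μ ++ baseRow μ)
        ≡⟨ List.map-++ rotate (dg' μ) (baseRow μ) ⟩
      map rotate (dg' μ) ++ map rotate (baseRow μ)
        ≡⟨ cong (λ b → map rotate (dg' μ) ++ map rotate b) baseRow-μ ⟩
      map rotate (dg' μ) ++ map rotate (innerBase ++ [ (n , 0) ])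
        ≡⟨ cong (map rotate (dg' μ) ++_) (List.map-++ rotate innerBase [ (n , 0) ]) ⟩
      map rotate (dg' μ) ++ (map rotate innerBase ++ [ rotate (n , 0) ])
        ≡⟨ cong (λ b → map rotate (dg' μ) ++ (map rotate innerBase ++ [ b ])) (rotate-last 0) ⟩
      map rotate (dg' μ) ++ (map rotate innerBase ++ [ (1 , 1) ]) ∎
      where open ≡-Reasoning

  module Transfer {A : Set} {_∙_ : Op₂ A} {ε : A} (isCM : IsCommutativeMonoid _≡_ _∙_ ε) where
    private module M = BigOperator isCM

    ⨁-dg'-μ' : ∀ f → M.⨁ f (dg' μ') ≡ f (1 , 1) ∙ M.⨁ (f ∘ rotate) (dg' μ)
    ⨁-dg'-μ' f = trans (M.⨁-↭ f dg'-μ'-↭) (cong (f (1 , 1) ∙_) (M.⨁-map f rotate (dg' μ)))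

    ⨁-dgHat-μ' : ∀ f → M.⨁ f (dgHat μ') ≡ f (1 , 0) ∙ M.⨁ (f ∘ rotate) (dgHat μ)
    ⨁-dgHat-μ' f = trans (M.⨁-↭ f dgHat-μ'-↭) (cong (f (1 , 0) ∙_) (M.⨁-map f rotate (dgHat μ)))

  open Transfer ℕ.+-0-isCommutativeMonoid

  Column : Box → Set
  Column (i , _) = i ∈[1, n ]

  Cell : Box → Set
  Cell (i , j) = i ∈[1, n ] × j ∈[1, at μ i ]

  dg'-μ-cells : All Cell (dg' μ)
  dg'-μ-cells = All.map (λ { {i , j} ((1≤i , i≤) , j∈) → (1≤i , subst (i ≤_) length-μ i≤) , j∈ }) (dg'-bounds μ)

  eqBox-rotate : ∀ {u v} → Column u → Column v → eqBox (rotate u) (rotate v) ≡ eqBox u v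
  eqBox-rotate {i , j} {i' , j'} (s≤s z≤n , i≤n) (s≤s z≤n , i'≤n) with columnOf i≤n | columnOf i'≤n
  ... | rightmost | rightmost rewrite rotate-last j | rotate-last j' | ≡ᵇ-refl n = refl
  ... | rightmost | inner i'≤m rewrite rotate-last j | rotate-inner j' i'≤m
                                      | ≡ᵇ-sym n i' | inner-≡ᵇ-last i'≤m = refl
  ... | inner i≤m | rightmost rewrite rotate-inner j i≤m | rotate-last j' | inner-≡ᵇ-last i≤m = refl
  ... | inner i≤m | inner i'≤m rewrite rotate-inner j i≤m | rotate-inner j' i'≤m = refl

  attacksLater-rotate : ∀ {u v} → Column u → Column v → attacksLater (rotate u) (rotate v) ≡ attacksLater u v
  attacksLater-rotate {i , j} {i' , j'} (s≤s z≤n , i≤n) (s≤s z≤n , i'≤n) with columnOf i≤n | columnOf i'≤n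
  ... | rightmost | rightmost rewrite rotate-last j | rotate-last j' | <ᵇ-irrefl n = refl
  ... | rightmost | inner i'≤m rewrite rotate-last j | rotate-inner j' i'≤m
                                      | <⇒<ᵇ-true (s≤s i'≤m) | ≤⇒<ᵇ-false (ℕ.m≤n⇒m≤1+n i'≤m) =
    trans (∧false∨∧true (j' ≡ᵇ suc j) (j' + 1 ≡ᵇ suc j))
          (trans (cong (_≡ᵇ suc j) (ℕ.+-comm j' 1)) (sym (∧true∨∧false (j' ≡ᵇ j) (j' + 1 ≡ᵇ j))))
  ... | inner i≤m | rightmost rewrite rotate-inner j i≤m | rotate-last j'
                                      | <⇒<ᵇ-true (s≤s i≤m) | ≤⇒<ᵇ-false (ℕ.m≤n⇒m≤1+n i≤m) =
    trans (∧true∨∧false (suc j' ≡ᵇ j) (suc j' + 1 ≡ᵇ j))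
          (trans (cong (_≡ᵇ j) (ℕ.+-comm 1 j')) (sym (∧false∨∧true (j' ≡ᵇ j) (j' + 1 ≡ᵇ j))))
  ... | inner i≤m | inner i'≤m rewrite rotate-inner j i≤m | rotate-inner j' i'≤m = refl

  attacks-rotate : ∀ {u v} → Column u → Column v → attacks (rotate u) (rotate v) ≡ attacks u v
  attacks-rotate {u} {v} u∈ v∈ = begin
    attacks (rotate u) (rotate v)
      ≡⟨ attacks≡attacksLater (rotate u) (rotate v) ⟩
    attacksLater (rotate u) (rotate v) ∨ attacksLater (rotate v) (rotate u)
      ≡⟨ cong₂ _∨_ (attacksLater-rotate u∈ v∈) (attacksLater-rotate v∈ u∈) ⟩
    attacksLater u v ∨ attacksLater v u
      ≡⟨ sym (attacks≡attacksLater u v) ⟩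
    attacks u v ∎
    where open ≡-Reasoning

  d-rotate : ∀ {i} j → i ∈[1, n ] → d (rotate (i , suc j)) ≡ rotate (i , j)
  d-rotate j (_ , i≤n) with columnOf i≤n
  ... | rightmost rewrite rotate-last (suc j) | rotate-last j = refl
  ... | inner i≤m rewrite rotate-inner (suc j) i≤m | rotate-inner j i≤m = refl

  leg-rotate : ∀ {u} → Column u → leg μ' (rotate u) ≡ leg μ u
  leg-rotate {i , j} i∈@(_ , i≤n) with columnOf i≤n
  ... | rightmost rewrite rotate-last j | at-μ-last = refl
  ... | inner i≤m rewrite rotate-inner j i≤m | at-μ'-suc (proj₁ i∈ , i≤m) = refl

  ⨁-columns-μ' : ∀ f → ⨁ f (range1 n) ≡ f 1 + ⨁ (f ∘ suc) (range1 m)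
  ⨁-columns-μ' f = trans (cong (⨁ f) (range1-suc m)) (cong (f 1 +_) (⨁-map f suc (range1 m)))

  ⨁-columns-μ : ∀ f → ⨁ f (range1 (length μ)) ≡ ⨁ f (range1 m) + f n
  ⨁-columns-μ f = begin
    ⨁ f (range1 (length μ))          ≡⟨ cong (λ k → ⨁ f (range1 k)) length-μ ⟩
    ⨁ f (range1 n)                   ≡⟨ cong (⨁ f) (range1-∷ʳ m) ⟩
    ⨁ f (range1 m ++ [ n ])          ≡⟨ ⨁-++ f (range1 m) [ n ] ⟩
    ⨁ f (range1 m) + (f n + 0)       ≡⟨ cong (⨁ f (range1 m) +_) (ℕ.+-identityʳ (f n)) ⟩
    ⨁ f (range1 m) + f n             ∎
    where open ≡-Reasoning

  inner-<ᵇ-last : ∀ {i} → i ≤ m → (i <ᵇ n) ≡ true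
  inner-<ᵇ-last i≤m = <⇒<ᵇ-true (s≤s i≤m)

  last-<ᵇ-inner : ∀ {i} → i ≤ m → (n <ᵇ i) ≡ false
  last-<ᵇ-inner i≤m = ≤⇒<ᵇ-false (ℕ.m≤n⇒m≤1+n i≤m)

  arm-rotate : ∀ {i} J → i ∈[1, n ] → arm μ' (rotate (i , suc J)) ≡ arm μ (i , suc J)
  arm-rotate {i} J (1≤i , i≤n) with columnOf i≤n
  ... | rightmost rewrite rotate-last (suc J) = begin
    arm μ' (1 , suc (suc J))                              ≡⟨ arm-by-columns μ' 1 (suc J) ⟩
    ⨁ (armColumn μ' 1 (suc J)) (range1 n)                ≡⟨ ⨁-columns-μ' (armColumn μ' 1 (suc J)) ⟩
    ⨁ (armColumn μ' 1 (suc J) ∘ suc) (range1 m)          ≡⟨ ⨁-cong-local (All.map shifted-column (range1-bounds m)) ⟩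
    ⨁ (armColumn μ n J) (range1 m)                       ≡⟨ sym (ℕ.+-identityʳ _) ⟩
    ⨁ (armColumn μ n J) (range1 m) + 0                   ≡⟨ cong (⨁ (armColumn μ n J) (range1 m) +_) (sym last-column) ⟩
    ⨁ (armColumn μ n J) (range1 m) + armColumn μ n J n   ≡⟨ sym (⨁-columns-μ (armColumn μ n J)) ⟩
    ⨁ (armColumn μ n J) (range1 (length μ))              ≡⟨ sym (arm-by-columns μ n J) ⟩
    arm μ (n , suc J)                                     ∎
    where
    open ≡-Reasoning
    last-column : armColumn μ n J n ≡ 0
    last-column rewrite <ᵇ-irrefl n = refl
    shifted-column : ∀ {i'} → i' ∈[1, m ] → armColumn μ' 1 (suc J) (suc i') ≡ armColumn μ n J i'
    shifted-column {suc i'} i'∈@(_ , i'≤m) rewrite at-μ'-suc i'∈ | at-μ-last | inner-<ᵇ-last i'≤m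
      | last-<ᵇ-inner i'≤m | <ᵇ-suc (at μ (suc i')) c = sym (ℕ.+-identityʳ _)
  ... | inner i≤m rewrite rotate-inner (suc J) i≤m = begin
    arm μ' (suc i , suc J)                                   ≡⟨ arm-by-columns μ' (suc i) J ⟩
    ⨁ (armColumn μ' (suc i) J) (range1 n)                   ≡⟨ ⨁-columns-μ' (armColumn μ' (suc i) J) ⟩
    armColumn μ' (suc i) J 1 + ⨁ (armColumn μ' (suc i) J ∘ suc) (range1 m)
                                                             ≡⟨ cong₂ _+_ first-column (⨁-cong-local (All.map shifted-column (range1-bounds m))) ⟩
    armColumn μ i J n + ⨁ (armColumn μ i J) (range1 m)       ≡⟨ ℕ.+-comm (armColumn μ i J n) _ ⟩
    ⨁ (armColumn μ i J) (range1 m) + armColumn μ i J n       ≡⟨ sym (⨁-columns-μ (armColumn μ i J)) ⟩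
    ⨁ (armColumn μ i J) (range1 (length μ))                 ≡⟨ sym (arm-by-columns μ i J) ⟩
    arm μ (i , suc J)                                        ∎
    where
    open ≡-Reasoning
    first-column : armColumn μ' (suc i) J 1 ≡ armColumn μ i J n
    first-column = first-column-of (1≤i , i≤m)
      where
      first-column-of : ∀ {i} → i ∈[1, m ] → armColumn μ' (suc i) J 1 ≡ armColumn μ i J n
      first-column-of {suc i} i∈@(_ , i≤m) rewrite at-μ'-suc i∈ | at-μ-last | inner-<ᵇ-last i≤m
        | last-<ᵇ-inner i≤m = ℕ.+-identityʳ _
    shifted-column : ∀ {i'} → i' ∈[1, m ] → armColumn μ' (suc i) J (suc i') ≡ armColumn μ i J i'
    shifted-column i'∈ rewrite at-μ'-suc i'∈ | at-μ'-suc (1≤i , i≤m) = refl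

  lowColumns : ℕ
  lowColumns = ⨁ (λ i → ⟦ at μ i ≤ᵇ c ⟧) (range1 m)

  arm-μ'-corner : arm μ' (1 , 1) ≡ lowColumns
  arm-μ'-corner = trans (arm-by-columns μ' 1 0) (trans (⨁-columns-μ' (armColumn μ' 1 0))
    (⨁-cong-local (All.map shifted-column (range1-bounds m))))
    where
    shifted-column : ∀ {i} → i ∈[1, m ] → armColumn μ' 1 0 (suc i) ≡ ⟦ at μ i ≤ᵇ c ⟧
    shifted-column {suc i} i∈ rewrite at-μ'-suc i∈ | <ᵇ-suc (at μ (suc i)) c with at μ (suc i) ≤ᵇ c
    ... | true  = refl
    ... | false = refl

  #lower≡lowColumns : ⨁ (λ i → ⟦ (i <ᵇ n) ∧ (at μ i ≤ᵇ at μ n) ⟧) (range1 (length μ)) ≡ lowColumns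
  #lower≡lowColumns rewrite at-μ-last = begin
    ⨁ (λ i → ⟦ (i <ᵇ n) ∧ (at μ i ≤ᵇ c) ⟧) (range1 (length μ))
      ≡⟨ ⨁-columns-μ (λ i → ⟦ (i <ᵇ n) ∧ (at μ i ≤ᵇ c) ⟧) ⟩
    ⨁ (λ i → ⟦ (i <ᵇ n) ∧ (at μ i ≤ᵇ c) ⟧) (range1 m) + ⟦ (n <ᵇ n) ∧ (at μ n ≤ᵇ c) ⟧
      ≡⟨ cong₂ _+_ (⨁-cong-local (All.map (λ {i} (_ , i≤m) → cong (λ b → ⟦ b ∧ (at μ i ≤ᵇ c) ⟧) (inner-<ᵇ-last i≤m))
                                          (range1-bounds m)))
                   (cong (λ b → ⟦ b ∧ (at μ n ≤ᵇ c) ⟧) (<ᵇ-irrefl n)) ⟩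
    lowColumns + 0
      ≡⟨ ℕ.+-identityʳ lowColumns ⟩
    lowColumns ∎
    where open ≡-Reasoning

  ⨁-arm-μ' : ⨁ (arm μ') (dg' μ') ≡ lowColumns + ⨁ (arm μ) (dg' μ)
  ⨁-arm-μ' = trans (⨁-dg'-μ' (arm μ'))
    (cong₂ _+_ arm-μ'-corner (⨁-cong-local (All.map (λ { {i , suc j} (i∈ , _) → arm-rotate j i∈ }) dg'-μ-cells)))

  pairsWithinν : ℕ
  pairsWithinν = ⨁ (λ i → ⨁ (λ j → ⟦ (i <ᵇ j) ∧ (at μ i ≤ᵇ at μ j) ⟧) (range1 m)) (range1 m)

  numPairs-μ : numPairs μ ≡ pairsWithinν + lowColumns
  numPairs-μ = begin
    numPairs μ
      ≡⟨ ⨁-cong (λ i → trans (count≡⨁⟦⟧ (P i) R) (⨁-columns-μ (⟦_⟧ ∘ P i))) R ⟩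
    ⨁ (λ i → ⨁ (⟦_⟧ ∘ P i) (range1 m) + ⟦ P i n ⟧) R
      ≡⟨ ⨁-columns-μ (λ i → ⨁ (⟦_⟧ ∘ P i) (range1 m) + ⟦ P i n ⟧) ⟩
    ⨁ (λ i → ⨁ (⟦_⟧ ∘ P i) (range1 m) + ⟦ P i n ⟧) (range1 m) + (⨁ (⟦_⟧ ∘ P n) (range1 m) + ⟦ P n n ⟧)
      ≡⟨ cong₂ _+_ (⨁-∙ (λ i → ⨁ (⟦_⟧ ∘ P i) (range1 m)) (λ i → ⟦ P i n ⟧) (range1 m)) last-row ⟩
    (pairsWithinν + ⨁ (λ i → ⟦ P i n ⟧) (range1 m)) + 0
      ≡⟨ ℕ.+-identityʳ _ ⟩
    pairsWithinν + ⨁ (λ i → ⟦ P i n ⟧) (range1 m)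
      ≡⟨ cong (pairsWithinν +_) (⨁-cong-local (All.map last-column (range1-bounds m))) ⟩
    pairsWithinν + lowColumns ∎
    where
    open ≡-Reasoning
    R : List ℕ
    R = range1 (length μ)
    P : ℕ → ℕ → Bool
    P i j = (i <ᵇ j) ∧ (at μ i ≤ᵇ at μ j)
    last-row : ⨁ (⟦_⟧ ∘ P n) (range1 m) + ⟦ P n n ⟧ ≡ 0
    last-row rewrite <ᵇ-irrefl n =
      trans (ℕ.+-identityʳ _)
            (⨁-ε (All.map (λ {j} (_ , j≤m) → cong (λ b → ⟦ b ∧ (at μ n ≤ᵇ at μ j) ⟧) (last-<ᵇ-inner j≤m)) (range1-bounds m)))
    last-column : ∀ {i} → i ∈[1, m ] → ⟦ P i n ⟧ ≡ ⟦ at μ i ≤ᵇ c ⟧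
    last-column (_ , i≤m) rewrite inner-<ᵇ-last i≤m | at-μ-last = refl

  numPairs-μ' : numPairs μ' + lowColumns ≡ pairsWithinν + m
  numPairs-μ' = begin
    numPairs μ' + lowColumns
      ≡⟨ cong (_+ lowColumns) (trans (⨁-cong (λ i → trans (count≡⨁⟦⟧ (P' i) (range1 n)) (⨁-columns-μ' (⟦_⟧ ∘ P' i))) (range1 n))
                                     (⨁-columns-μ' (λ i → ⟦ P' i 1 ⟧ + ⨁ (⟦_⟧ ∘ P' i ∘ suc) (range1 m)))) ⟩
    (⨁ (⟦_⟧ ∘ P' 1 ∘ suc) (range1 m) + ⨁ (λ i → ⨁ (⟦_⟧ ∘ P' (suc i) ∘ suc) (range1 m)) (range1 m)) + lowColumns
      ≡⟨ cong (λ x → x + lowColumns) (cong₂ _+_ (⨁-cong-local (All.map first-row (range1-bounds m)))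
            (⨁-cong-local (All.map (λ i∈ → ⨁-cong-local (All.map (shifted i∈) (range1-bounds m))) (range1-bounds m)))) ⟩
    (⨁ (λ j → ⟦ c <ᵇ at μ j ⟧) (range1 m) + pairsWithinν) + lowColumns
      ≡⟨ rearrange (⨁ (λ j → ⟦ c <ᵇ at μ j ⟧) (range1 m)) pairsWithinν lowColumns ⟩
    pairsWithinν + (⨁ (λ j → ⟦ c <ᵇ at μ j ⟧) (range1 m) + lowColumns)
      ≡⟨ cong (pairsWithinν +_) (sym (⨁-∙ (λ j → ⟦ c <ᵇ at μ j ⟧) (λ j → ⟦ at μ j ≤ᵇ c ⟧) (range1 m))) ⟩
    pairsWithinν + ⨁ (λ j → ⟦ c <ᵇ at μ j ⟧ + ⟦ at μ j ≤ᵇ c ⟧) (range1 m)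
      ≡⟨ cong (pairsWithinν +_) (trans (⨁-cong (λ j → ⟦<ᵇ⟧+⟦≤ᵇ⟧ c (at μ j)) (range1 m))
                                       (trans (⨁-1≡length (range1 m)) (length-range1 m))) ⟩
    pairsWithinν + m ∎
    where
    open ≡-Reasoning
    P' : ℕ → ℕ → Bool
    P' i j = (i <ᵇ j) ∧ (at μ' i ≤ᵇ at μ' j)
    first-row : ∀ {j} → j ∈[1, m ] → ⟦ P' 1 (suc j) ⟧ ≡ ⟦ c <ᵇ at μ j ⟧
    first-row {suc j} j∈ rewrite at-μ'-suc j∈ = refl
    shifted : ∀ {i j} → i ∈[1, m ] → j ∈[1, m ] → ⟦ P' (suc i) (suc j) ⟧ ≡ ⟦ (i <ᵇ j) ∧ (at μ i ≤ᵇ at μ j) ⟧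
    shifted i∈ j∈ rewrite at-μ'-suc i∈ | at-μ'-suc j∈ = refl
    rearrange : ∀ x y z → (x + y) + z ≡ y + (x + z)
    rearrange = solve-∀

  cycle-≡ᵇ : ∀ {a b} → a ∈[1, n ] → b ∈[1, n ] → (cycle a ≡ᵇ cycle b) ≡ (a ≡ᵇ b)
  cycle-≡ᵇ {suc a} {suc b} a∈@(s≤s z≤n , a≤n) b∈@(s≤s z≤n , b≤n) with columnOf a≤n | columnOf b≤n
  ... | rightmost | rightmost rewrite cycle-last | ≡ᵇ-refl n = refl
  ... | rightmost | inner b≤m rewrite cycle-last | cycle-inner (proj₁ b∈ , b≤m) | ≡ᵇ-sym n (suc b) | inner-≡ᵇ-last b≤m = refl
  ... | inner a≤m | rightmost rewrite cycle-last | cycle-inner (proj₁ a∈ , a≤m) | inner-≡ᵇ-last a≤m = refl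
  ... | inner a≤m | inner b≤m rewrite cycle-inner (proj₁ a∈ , a≤m) | cycle-inner (proj₁ b∈ , b≤m) = refl

  -- b < a is preserved by the cycle unless one of a, b is n
  cycle-descent : ∀ {a b} w → a ∈[1, n ] → b ∈[1, n ] →
    (if cycle b <ᵇ cycle a then w else 0) + (if a ≡ᵇ n then w else 0)
    ≡ (if b <ᵇ a then w else 0) + (if b ≡ᵇ n then w else 0)
  cycle-descent {suc a} {suc b} w a∈@(s≤s z≤n , a≤n) b∈@(s≤s z≤n , b≤n) with columnOf a≤n | columnOf b≤n
  ... | rightmost | rightmost rewrite cycle-last | <ᵇ-irrefl n | ≡ᵇ-refl n = refl
  ... | rightmost | inner b≤m rewrite cycle-last | cycle-inner (proj₁ b∈ , b≤m) | ≡ᵇ-refl n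
                                    | inner-<ᵇ-last b≤m | inner-≡ᵇ-last b≤m = sym (ℕ.+-identityʳ w)
  ... | inner a≤m | rightmost rewrite cycle-last | cycle-inner (proj₁ a∈ , a≤m) | ≡ᵇ-refl n
                                    | last-<ᵇ-inner a≤m | inner-≡ᵇ-last a≤m = ℕ.+-identityʳ w
  ... | inner a≤m | inner b≤m rewrite cycle-inner (proj₁ a∈ , a≤m) | cycle-inner (proj₁ b∈ , b≤m)
                                    | inner-≡ᵇ-last a≤m | inner-≡ᵇ-last b≤m = refl

  corner-unattacked : ∀ τ {v} → Column v → not (attacks (1 , 0) (rotate v)) ∨ not (1 ≡ᵇ hat τ (rotate v)) ≡ true
  corner-unattacked τ {suc i , j} (s≤s z≤n , i≤n) with columnOf i≤n
  ... | rightmost rewrite rotate-last j with j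
  ...   | zero  = refl
  ...   | suc _ = refl
  corner-unattacked τ {suc i , j} (s≤s z≤n , i≤n) | inner i≤m rewrite rotate-inner j i≤m with j
  ...   | zero        = refl
  ...   | suc zero    = refl
  ...   | suc (suc _) = refl

  corner-unattacking : ∀ τ {u} → Column u → not (attacks (rotate u) (1 , 0)) ∨ not (hat τ (rotate u) ≡ᵇ 1) ≡ true
  corner-unattacking τ {suc i , j} (s≤s z≤n , i≤n) with columnOf i≤n
  ... | rightmost rewrite rotate-last j with j
  ...   | zero  = refl
  ...   | suc _ = refl
  corner-unattacking τ {suc i , j} (s≤s z≤n , i≤n) | inner i≤m rewrite rotate-inner j i≤m with j
  ...   | zero        = refl
  ...   | suc zero    = refl
  ...   | suc (suc _) = refl

  corner-attacksLater : ∀ {v} → Column v → attacksLater (1 , 0) (rotate v) ≡ false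
  corner-attacksLater {suc i , j} (s≤s z≤n , i≤n) with columnOf i≤n
  ... | rightmost rewrite rotate-last j       = refl
  ... | inner i≤m rewrite rotate-inner j i≤m with j
  ...   | zero  = refl
  ...   | suc _ = refl

  -- the inversions ((i + 1 , 0) , (1 , 0)) of the new base row, for i < n
  attacksLater-corner : ∀ τ {u} → Column u →
    attacksLater (rotate u) (1 , 0) ∧ (1 <ᵇ hat τ (rotate u)) ≡ (proj₂ u ≡ᵇ 0) ∧ (proj₁ u <ᵇ n)
  attacksLater-corner τ {suc i , j} (s≤s z≤n , i≤n) with columnOf i≤n
  ... | rightmost rewrite rotate-last j | <ᵇ-irrefl n with j
  ...   | zero  = refl
  ...   | suc _ = refl
  attacksLater-corner τ {suc i , j} (s≤s z≤n , i≤n) | inner i≤m rewrite rotate-inner j i≤m | inner-<ᵇ-last i≤m with j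
  ...   | zero        = refl
  ...   | suc zero    = refl
  ...   | suc (suc _) = refl

  lastColumn-boxes : All (λ (i , j) → i ≡ n × 1 ≤ j) lastColumn
  lastColumn-boxes = All.map⁺ (All.map (λ (1≤j , _) → refl , 1≤j) (range1-bounds c))

  innerColumns-boxes : All (λ (i , j) → i ∈[1, m ] × 1 ≤ j) innerColumns
  innerColumns-boxes = All.concat⁺ (All.map⁺ (All.map
    (λ {i} i∈ → All.map⁺ (All.map (λ (1≤j , _) → i∈ , 1≤j) (range1-bounds (at μ i))))
    (range1-bounds m)))

  length-lastColumn : length lastColumn ≡ c
  length-lastColumn = trans (List.length-map {B = Box} (n ,_) (range1 c)) (length-range1 c)

  length-dg'-μ : length (dg' μ) ≡ length innerColumns + c
  length-dg'-μ = trans (cong length dg'-μ)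
    (trans (List.length-++ innerColumns) (cong (length innerColumns +_) length-lastColumn))

  length-dg'-μ' : length (dg' μ') ≡ suc (c + length innerColumns)
  length-dg'-μ' = trans (cong length dg'-μ') (cong suc (trans (List.length-++ (map rotate lastColumn))
    (cong₂ _+_ (trans (List.length-map rotate lastColumn) length-lastColumn) (List.length-map rotate innerColumns))))

  rotate-≢-corner : ∀ {i} j → i ∈[1, n ] → eqBox (rotate (i , suc j)) (1 , 1) ≡ false
  rotate-≢-corner {suc i} j (s≤s z≤n , i≤n) with columnOf i≤n
  ... | rightmost rewrite rotate-last (suc j)      = refl
  ... | inner i≤m rewrite rotate-inner (suc j) i≤m = refl

  hat-rotate-suc : ∀ τ {i} j → i ∈[1, n ] → hat τ (rotate (i , suc j)) ≡ lookupF τ (rotate (i , suc j))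
  hat-rotate-suc τ j (_ , i≤n) with columnOf i≤n
  ... | rightmost rewrite rotate-last (suc j)      = refl
  ... | inner i≤m rewrite rotate-inner (suc j) i≤m = refl

  module ⋀-Transfer = Transfer Bool.∧-isCommutativeMonoid
  module ∏-Transfer = Transfer ℚ.*-1-isCommutativeMonoid

  xAt-rotated : ∀ x₁ xs → length xs ≡ m → ∀ r {k} → k ∈[1, n ] →
    xAt (xs ++ [ r * x₁ ]) k ≡ (if k ≡ᵇ n then r else 1ℚ) * xAt (x₁ ∷ xs) (cycle k)
  xAt-rotated x₁ xs |xs| r {suc k} (s≤s z≤n , k≤n) with columnOf k≤n
  ... | rightmost rewrite ≡ᵇ-refl n = subst (λ l → xAt (xs ++ [ r * x₁ ]) (suc l) ≡ r * x₁) |xs| (xAt-∷ʳ-last xs (r * x₁))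
  ... | inner k≤m rewrite inner-≡ᵇ-last k≤m =
    trans (xAt-++ˡ xs [ r * x₁ ] (s≤s z≤n , subst (suc k ≤_) (sym |xs|) k≤m)) (sym (ℚ.*-identityˡ _))

  -- The filling σ of μ with values wInner on the columns 1 … m and wLast on column n, and the
  -- filling σ' of μ' with σ' (1 , 1) = 1 and σ' ∘ rotate = cycle ∘ σ.
  module Filling (wLast wInner : List ℕ) (|wLast| : length wLast ≡ c) (|wInner| : length wInner ≡ length innerColumns)
                 (wLast-range : All (_∈[1, n ]) wLast) (wInner-range : All (_∈[1, n ]) wInner) where

    τLast τInner σ σ' : Filling
    τLast = zip lastColumn wLast
    τInner = zip innerColumns wInner
    σ  = zip (dg' μ) (wInner ++ wLast)
    σ' = zip (dg' μ') (1 ∷ (map cycle wLast ++ map cycle wInner))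

    σ≡ : σ ≡ τInner ++ τLast
    σ≡ = trans (cong (λ L → zip L (wInner ++ wLast)) dg'-μ) (zip-++ innerColumns lastColumn wInner wLast (sym |wInner|))

    σ'≡ : σ' ≡ ((1 , 1) , 1) ∷ map (Product.map rotate cycle) (τLast ++ τInner)
    σ'≡ = trans (cong (λ L → zip L (1 ∷ (map cycle wLast ++ map cycle wInner))) dg'-μ') (cong (((1 , 1) , 1) ∷_) (begin
      zip (map rotate lastColumn ++ map rotate innerColumns) (map cycle wLast ++ map cycle wInner)
        ≡⟨ zip-++ (map rotate lastColumn) (map rotate innerColumns) (map cycle wLast) (map cycle wInner)
                  (trans (List.length-map rotate lastColumn) (trans length-lastColumn (trans (sym |wLast|) (sym (List.length-map cycle wLast))))) ⟩
      zip (map rotate lastColumn) (map cycle wLast) ++ zip (map rotate innerColumns) (map cycle wInner)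
        ≡⟨ cong₂ _++_ (List.zip-map rotate cycle lastColumn wLast) (List.zip-map rotate cycle innerColumns wInner) ⟩
      map (Product.map rotate cycle) τLast ++ map (Product.map rotate cycle) τInner
        ≡⟨ sym (List.map-++ (Product.map rotate cycle) τLast τInner) ⟩
      map (Product.map rotate cycle) (τLast ++ τInner) ∎))
      where open ≡-Reasoning

    hat-σ'-corner : hat σ' (1 , 1) ≡ 1
    hat-σ'-corner = cong (λ τ → lookupF τ (1 , 1)) σ'≡

    keys-in-columns : All (Column ∘ proj₁) (τLast ++ τInner)
    keys-in-columns = All.++⁺
      (All-zip-keys wLast (All.map (λ { (refl , _) → s≤s z≤n , ℕ.≤-refl }) lastColumn-boxes))
      (All-zip-keys wInner (All.map (λ ((1≤i , i≤m) , _) → 1≤i , ℕ.m≤n⇒m≤1+n i≤m) innerColumns-boxes))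

    τLast-τInner-disjoint : Keys-disjoint τLast τInner
    τLast-τInner-disjoint = All-zip-keys wLast (All.map (λ { {_ , j} (refl , _) → All-zip-keys wInner (All.map
      (λ { {i' , j'} ((_ , i'≤m) , _) → cong (_∧ (j ≡ᵇ j')) (trans (≡ᵇ-sym n i') (inner-≡ᵇ-last i'≤m)) })
      innerColumns-boxes) }) lastColumn-boxes)

    lookupF-rotate : ∀ {i} j → i ∈[1, n ] → lookupF σ' (rotate (i , suc j)) ≡ cycle (lookupF σ (i , suc j))
    lookupF-rotate {i} j i∈ = begin
      lookupF σ' (rotate u)
        ≡⟨ cong (λ τ → lookupF τ (rotate u)) σ'≡ ⟩
      (if eqBox (rotate u) (1 , 1) then 1 else lookupF (map (Product.map rotate cycle) (τLast ++ τInner)) (rotate u))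
        ≡⟨ cong (λ b → if b then 1 else lookupF (map (Product.map rotate cycle) (τLast ++ τInner)) (rotate u)) (rotate-≢-corner j i∈) ⟩
      lookupF (map (Product.map rotate cycle) (τLast ++ τInner)) (rotate u)
        ≡⟨ lookupF-map rotate cycle (τLast ++ τInner) u refl (All.map (eqBox-rotate i∈) keys-in-columns) ⟩
      cycle (lookupF (τLast ++ τInner) u)
        ≡⟨ cong cycle (trans (lookupF-swap τLast τInner u τLast-τInner-disjoint) (cong (λ τ → lookupF τ u) (sym σ≡))) ⟩
      cycle (lookupF σ u) ∎
      where
      open ≡-Reasoning
      u : Box
      u = (i , suc j)

    hat-rotate : ∀ {u} → Column u → hat σ' (rotate u) ≡ cycle (hat σ u)
    hat-rotate {i , zero} i∈@(1≤i , i≤n) with columnOf i≤n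
    ... | rightmost rewrite rotate-last 0 = trans hat-σ'-corner (sym cycle-last)
    ... | inner i≤m rewrite rotate-inner 0 i≤m = sym (cycle-inner (1≤i , i≤m))
    hat-rotate {i , suc j} i∈ = trans (hat-rotate-suc σ' j i∈) (lookupF-rotate j i∈)

    Valued : Box → Set
    Valued u = Column u × hat σ u ∈[1, n ]

    valued : All Valued (dgHat μ)
    valued = All.++⁺
      (All.map in-dg' (All.zip (dg'-μ-cells , lookupF-zip-All (dg' μ) (wInner ++ wLast) |dg'| (All.++⁺ wInner-range wLast-range))))
      (All.map⁺ (All.map (λ {i} (1≤i , i≤) → let i∈ = 1≤i , subst (i ≤_) length-μ i≤ in i∈ , i∈) (range1-bounds (length μ))))
      where
      |dg'| : length (dg' μ) ≡ length (wInner ++ wLast)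
      |dg'| = trans length-dg'-μ (trans (cong₂ _+_ (sym |wInner|) (sym |wLast|)) (sym (List.length-++ wInner)))
      in-dg' : ∀ {u} → Cell u × lookupF σ u ∈[1, n ] → Valued u
      in-dg' {i , suc j} (cell , v∈) = proj₁ cell , v∈

    nonAttacking-σ' : nonAttacking μ' σ' ≡ nonAttacking μ σ
    nonAttacking-σ' = begin
      nonAttacking μ' σ'
        ≡⟨ nonAttacking≡⋀ μ' σ' ⟩
      ⋀.⨁ (λ u → ⋀.⨁ (compatible σ' u) (dgHat μ')) (dgHat μ')
        ≡⟨ ⋀-Transfer.⨁-dgHat-μ' (λ u → ⋀.⨁ (compatible σ' u) (dgHat μ')) ⟩
      ⋀.⨁ (compatible σ' (1 , 0)) (dgHat μ') ∧ ⋀.⨁ (λ u → ⋀.⨁ (compatible σ' (rotate u)) (dgHat μ')) (dgHat μ)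
        ≡⟨ cong₂ _∧_ corner-row (⋀.⨁-cong-local (All.map rotated-row valued)) ⟩
      ⋀.⨁ (λ u → ⋀.⨁ (compatible σ u) (dgHat μ)) (dgHat μ)
        ≡⟨ sym (nonAttacking≡⋀ μ σ) ⟩
      nonAttacking μ σ ∎
      where
      open ≡-Reasoning
      corner-row : ⋀.⨁ (compatible σ' (1 , 0)) (dgHat μ') ≡ true
      corner-row = trans (⋀-Transfer.⨁-dgHat-μ' (compatible σ' (1 , 0)))
        (⋀.⨁-ε (All.map (λ (v∈ , _) → corner-unattacked σ' v∈) valued))
      rotated-row : ∀ {u} → Valued u → ⋀.⨁ (compatible σ' (rotate u)) (dgHat μ') ≡ ⋀.⨁ (compatible σ u) (dgHat μ)
      rotated-row {u} (u∈ , hu∈) = trans (⋀-Transfer.⨁-dgHat-μ' (compatible σ' (rotate u)))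
        (trans (cong (_∧ ⋀.⨁ (compatible σ' (rotate u) ∘ rotate) (dgHat μ)) (corner-unattacking σ' u∈))
               (⋀.⨁-cong-local (All.map rotated valued)))
        where
        rotated : ∀ {v} → Valued v → compatible σ' (rotate u) (rotate v) ≡ compatible σ u v
        rotated (v∈ , hv∈) = cong₂ (λ a e → not a ∨ not e) (attacks-rotate u∈ v∈)
          (trans (cong₂ _≡ᵇ_ (hat-rotate u∈) (hat-rotate v∈)) (cycle-≡ᵇ hu∈ hv∈))

    laterN earlierN : ℕ
    laterN   = ⨁ (λ u → ⨁ (λ v → ⟦ attacksLater u v ∧ (hat σ u ≡ᵇ n) ⟧) (dgHat μ)) (dgHat μ)
    earlierN = ⨁ (λ u → ⨁ (λ v → ⟦ attacksLater u v ∧ (hat σ v ≡ᵇ n) ⟧) (dgHat μ)) (dgHat μ)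

    baseRow-inner-count : ⨁ (λ u → ⟦ (proj₂ u ≡ᵇ 0) ∧ (proj₁ u <ᵇ n) ⟧) (dgHat μ) ≡ m
    baseRow-inner-count = begin
      ⨁ f (dg' μ ++ baseRow μ)                      ≡⟨ ⨁-++ f (dg' μ) (baseRow μ) ⟩
      ⨁ f (dg' μ) + ⨁ f (baseRow μ)                 ≡⟨ cong₂ _+_ (⨁-ε (All.map (λ { {_ , suc _} _ → refl }) dg'-μ-cells))
                                                                  (⨁-map f (_, 0) (range1 (length μ))) ⟩
      ⨁ (λ i → ⟦ i <ᵇ n ⟧) (range1 (length μ))      ≡⟨ ⨁-columns-μ (λ i → ⟦ i <ᵇ n ⟧) ⟩
      ⨁ (λ i → ⟦ i <ᵇ n ⟧) (range1 m) + ⟦ n <ᵇ n ⟧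
        ≡⟨ cong₂ _+_ (⨁-cong-local (All.map (λ (_ , i≤m) → cong ⟦_⟧ (inner-<ᵇ-last i≤m)) (range1-bounds m)))
                     (cong ⟦_⟧ (<ᵇ-irrefl n)) ⟩
      ⨁ (λ _ → 1) (range1 m) + 0                    ≡⟨ trans (ℕ.+-identityʳ _) (trans (⨁-1≡length (range1 m)) (length-range1 m)) ⟩
      m                                             ∎
      where
      open ≡-Reasoning
      f : Box → ℕ
      f u = ⟦ (proj₂ u ≡ᵇ 0) ∧ (proj₁ u <ᵇ n) ⟧

    baseInversion cycledInversion : Box → Box → ℕ
    baseInversion u _     = ⟦ (proj₂ u ≡ᵇ 0) ∧ (proj₁ u <ᵇ n) ⟧
    cycledInversion u v = ⟦ attacksLater u v ∧ (cycle (hat σ v) <ᵇ cycle (hat σ u)) ⟧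

    ⨁-inversion-corner : ⨁ (inversion σ' (1 , 0)) (dgHat μ') ≡ 0
    ⨁-inversion-corner = trans (⨁-dgHat-μ' (inversion σ' (1 , 0)))
      (⨁-ε (All.map (λ {v} (v∈ , _) → cong (λ b → ⟦ b ∧ (hat σ' (rotate v) <ᵇ 1) ⟧) (corner-attacksLater v∈)) valued))

    ⨁-inversion-rotate : ∀ {u} → Valued u →
      ⨁ (inversion σ' (rotate u)) (dgHat μ') ≡ baseInversion u u + ⨁ (cycledInversion u) (dgHat μ)
    ⨁-inversion-rotate {u} (u∈ , _) = trans (⨁-dgHat-μ' (inversion σ' (rotate u)))
      (cong₂ _+_ (cong ⟦_⟧ (attacksLater-corner σ' u∈))
                 (⨁-cong-local (All.map (λ {v} (v∈ , _) → cong₂ (λ a b → ⟦ a ∧ b ⟧) (attacksLater-rotate {u} {v} u∈ v∈)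
                                                                (cong₂ _<ᵇ_ (hat-rotate v∈) (hat-rotate u∈))) valued)))

    cycledInversion+laterN : ∀ {u v} → Valued u → Valued v →
      cycledInversion u v + ⟦ attacksLater u v ∧ (hat σ u ≡ᵇ n) ⟧ ≡ inversion σ u v + ⟦ attacksLater u v ∧ (hat σ v ≡ᵇ n) ⟧
    cycledInversion+laterN {u} {v} (_ , hu∈) (_ , hv∈) = begin
      cycledInversion u v + ⟦ A ∧ (hat σ u ≡ᵇ n) ⟧
        ≡⟨ cong₂ _+_ (⟦∧⟧≡if A _) (⟦∧⟧≡if A _) ⟩
      (if cycle (hat σ v) <ᵇ cycle (hat σ u) then ⟦ A ⟧ else 0) + (if hat σ u ≡ᵇ n then ⟦ A ⟧ else 0)
        ≡⟨ cycle-descent ⟦ A ⟧ hu∈ hv∈ ⟩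
      (if hat σ v <ᵇ hat σ u then ⟦ A ⟧ else 0) + (if hat σ v ≡ᵇ n then ⟦ A ⟧ else 0)
        ≡⟨ sym (cong₂ _+_ (⟦∧⟧≡if A _) (⟦∧⟧≡if A _)) ⟩
      inversion σ u v + ⟦ A ∧ (hat σ v ≡ᵇ n) ⟧ ∎
      where
      open ≡-Reasoning
      A : Bool
      A = attacksLater u v

    numInv-σ' : numInv μ' σ' + laterN ≡ m + (numInv μ σ + earlierN)
    numInv-σ' = begin
      numInv μ' σ' + laterN
        ≡⟨ cong (_+ laterN) (trans (numInv≡⨁inversion μ' σ') (⨁-dgHat-μ' (λ u → ⨁ (inversion σ' u) (dgHat μ')))) ⟩
      ⨁ (inversion σ' (1 , 0)) (dgHat μ') + ⨁ (λ u → ⨁ (inversion σ' (rotate u)) (dgHat μ')) (dgHat μ) + laterN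
        ≡⟨ cong (_+ laterN) (cong₂ _+_ ⨁-inversion-corner (⨁-cong-local (All.map ⨁-inversion-rotate valued))) ⟩
      ⨁ (λ u → baseInversion u u + ⨁ (cycledInversion u) (dgHat μ)) (dgHat μ) + laterN
        ≡⟨ cong (_+ laterN) (⨁-∙ (λ u → baseInversion u u) (λ u → ⨁ (cycledInversion u) (dgHat μ)) (dgHat μ)) ⟩
      (⨁ (λ u → baseInversion u u) (dgHat μ) + ⨁ (λ u → ⨁ (cycledInversion u) (dgHat μ)) (dgHat μ)) + laterN
        ≡⟨ ℕ.+-assoc (⨁ (λ u → baseInversion u u) (dgHat μ)) _ laterN ⟩
      ⨁ (λ u → baseInversion u u) (dgHat μ) + (⨁ (λ u → ⨁ (cycledInversion u) (dgHat μ)) (dgHat μ) + laterN)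
        ≡⟨ cong₂ _+_ baseRow-inner-count (sym (⨁-∙ (λ u → ⨁ (cycledInversion u) (dgHat μ)) (λ u → ⨁ (laterAt u) (dgHat μ)) (dgHat μ))) ⟩
      m + ⨁ (λ u → ⨁ (cycledInversion u) (dgHat μ) + ⨁ (laterAt u) (dgHat μ)) (dgHat μ)
        ≡⟨ cong (m +_) (⨁-cong-local (All.map (λ {u} u∈ → trans (sym (⨁-∙ (cycledInversion u) (laterAt u) (dgHat μ)))
                         (⨁-cong-local (All.map (λ {v} v∈ → cycledInversion+laterN {u} {v} u∈ v∈) valued))) valued)) ⟩
      m + ⨁ (λ u → ⨁ (λ v → inversion σ u v + earlierAt u v) (dgHat μ)) (dgHat μ)
        ≡⟨ cong (m +_) (trans (⨁-cong (λ u → ⨁-∙ (inversion σ u) (earlierAt u) (dgHat μ)) (dgHat μ))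
                              (⨁-∙ (λ u → ⨁ (inversion σ u) (dgHat μ)) (λ u → ⨁ (earlierAt u) (dgHat μ)) (dgHat μ))) ⟩
      m + (⨁ (λ u → ⨁ (inversion σ u) (dgHat μ)) (dgHat μ) + earlierN)
        ≡⟨ cong (λ x → m + (x + earlierN)) (sym (numInv≡⨁inversion μ σ)) ⟩
      m + (numInv μ σ + earlierN) ∎
      where
      open ≡-Reasoning
      laterAt earlierAt : Box → Box → ℕ
      laterAt u v   = ⟦ attacksLater u v ∧ (hat σ u ≡ᵇ n) ⟧
      earlierAt u v = ⟦ attacksLater u v ∧ (hat σ v ≡ᵇ n) ⟧

    valued-at : ∀ {i j} → i ∈[1, n ] → j ≤ at μ i → hat σ (i , j) ∈[1, n ]
    valued-at {i} {zero}  i∈ _   = i∈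
    valued-at {i} {suc j} i∈ j≤M = proj₂ (All.lookup valued (∈-++⁺ˡ
      (∈-dg' μ (proj₁ i∈ , subst (i ≤_) (sym length-μ) (proj₂ i∈)) (s≤s z≤n , j≤M))))

    valued-cell : ∀ {u} → Cell u → hat σ u ∈[1, n ] × hat σ (d u) ∈[1, n ]
    valued-cell {i , suc j} (i∈ , (_ , j<M)) = valued-at i∈ j<M , valued-at i∈ (ℕ.≤-trans (ℕ.n≤1+n j) j<M)

    atN belowN : (Box → ℕ) → Box → ℕ
    atN f u    = if hat σ u ≡ᵇ n then f u else 0
    belowN f u = if hat σ (d u) ≡ᵇ n then f u else 0

    above : Box → Box
    above (i , j) = (i , suc j)

    descents-rotate : (wt' wt : Box → ℕ) → (∀ {u} → Cell u → wt' (rotate u) ≡ wt u) →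
      ⨁ (onDescents σ' wt') (dg' μ') + ⨁ (atN wt) (dg' μ) ≡ ⨁ (onDescents σ wt) (dg' μ) + ⨁ (belowN wt) (dg' μ)
    descents-rotate wt' wt wt-rotate = begin
      ⨁ (onDescents σ' wt') (dg' μ') + ⨁ (atN wt) (dg' μ)
        ≡⟨ cong (_+ ⨁ (atN wt) (dg' μ)) (trans (⨁-dg'-μ' (onDescents σ' wt'))
                                                (cong₂ _+_ corner (⨁-cong-local (All.map rotated dg'-μ-cells)))) ⟩
      ⨁ cycled (dg' μ) + ⨁ (atN wt) (dg' μ)
        ≡⟨ sym (⨁-∙ cycled (atN wt) (dg' μ)) ⟩
      ⨁ (λ u → cycled u + atN wt u) (dg' μ)
        ≡⟨ ⨁-cong-local (All.map (λ {u} u∈ → cycle-descent (wt u) (proj₁ (valued-cell u∈)) (proj₂ (valued-cell u∈))) dg'-μ-cells) ⟩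
      ⨁ (λ u → onDescents σ wt u + belowN wt u) (dg' μ)
        ≡⟨ ⨁-∙ (onDescents σ wt) (belowN wt) (dg' μ) ⟩
      ⨁ (onDescents σ wt) (dg' μ) + ⨁ (belowN wt) (dg' μ) ∎
      where
      open ≡-Reasoning
      cycled : Box → ℕ
      cycled u = if cycle (hat σ (d u)) <ᵇ cycle (hat σ u) then wt u else 0
      corner : onDescents σ' wt' (1 , 1) ≡ 0
      corner rewrite hat-σ'-corner = refl
      rotated : ∀ {u} → Cell u → onDescents σ' wt' (rotate u) ≡ cycled u
      rotated {i , suc j} u∈@(i∈ , _) = cong₂ (λ b w → if b then w else 0)
        (cong₂ _<ᵇ_ (trans (cong (hat σ') (d-rotate j i∈)) (hat-rotate i∈)) (hat-rotate i∈)) (wt-rotate u∈)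

    armN armBelowN armAboveN : ℕ
    armN      = ⨁ (atN (arm μ)) (dg' μ)
    armBelowN = ⨁ (belowN (arm μ)) (dg' μ)
    armAboveN = ⨁ (atN (arm μ ∘ above)) (dgHat μ)

    -- the arm of the box above the top of a column is 0
    armAboveN≡armBelowN : armAboveN ≡ armBelowN
    armAboveN≡armBelowN = trans (⨁-dgHat μ _) (trans (⨁-cong column-shift (range1 (length μ))) (sym (⨁-dg' μ _)))
      where
      column-shift : ∀ i → ⨁ (λ j → if hat σ (i , j) ≡ᵇ n then arm μ (i , suc j) else 0) (upTo (suc (at μ i)))
                   ≡ ⨁ (λ j → if hat σ (i , j ∸ 1) ≡ᵇ n then arm μ (i , j) else 0) (range1 (at μ i))
      column-shift i = begin
        ⨁ g (upTo (suc M))        ≡⟨ cong (⨁ g) (sym (List.upTo-∷ʳ M)) ⟩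
        ⨁ g (upTo M ++ [ M ])     ≡⟨ ⨁-++ g (upTo M) [ M ] ⟩
        ⨁ g (upTo M) + (g M + 0)  ≡⟨ cong (λ x → ⨁ g (upTo M) + (x + 0)) top ⟩
        ⨁ g (upTo M) + 0          ≡⟨ ℕ.+-identityʳ _ ⟩
        ⨁ g (upTo M)              ≡⟨ sym (⨁-map (λ j → if hat σ (i , j ∸ 1) ≡ᵇ n then arm μ (i , j) else 0) suc (upTo M)) ⟩
        ⨁ (λ j → if hat σ (i , j ∸ 1) ≡ᵇ n then arm μ (i , j) else 0) (range1 M) ∎
        where
        open ≡-Reasoning
        M : ℕ
        M = at μ i
        g : ℕ → ℕ
        g j = if hat σ (i , j) ≡ᵇ n then arm μ (i , suc j) else 0
        top : g M ≡ 0
        top with hat σ (i , M) ≡ᵇ n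
        ... | true  = arm-top μ i
        ... | false = refl

    laterN≡ : laterN ≡ ⨁ (atN (later μ)) (dgHat μ)
    laterN≡ = ⨁-cong (λ u → ⨁-⟦∧⟧ (attacksLater u) (hat σ u ≡ᵇ n) (dgHat μ)) (dgHat μ)

    earlierN≡ : earlierN ≡ ⨁ (atN (earlier μ)) (dgHat μ)
    earlierN≡ = trans (⨁-comm (λ u v → ⟦ attacksLater u v ∧ (hat σ v ≡ᵇ n) ⟧) (dgHat μ) (dgHat μ))
                      (⨁-cong (λ v → ⨁-⟦∧⟧ (λ u → attacksLater u v) (hat σ v ≡ᵇ n) (dgHat μ)) (dgHat μ))

    cell-balance : ∀ {u} → Cell u → atN (later μ) u + atN (arm μ ∘ above) u ≡ atN (earlier μ) u + atN (arm μ) u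
    cell-balance {i , suc J} (_ , (_ , J<M)) with hat σ (i , suc J) ≡ᵇ n
    ... | true  = later+arm-above≡earlier+arm μ i J J<M
    ... | false = refl

    baseRow-balance : ⨁ (λ u → atN (later μ) u + atN (arm μ ∘ above) u) (baseRow μ) ≡ ⨁ (atN (earlier μ)) (baseRow μ) + lowColumns
    baseRow-balance = begin
      ⨁ (λ u → fl u + fa u) (baseRow μ)
        ≡⟨ cong (⨁ (λ u → fl u + fa u)) baseRow-μ ⟩
      ⨁ (λ u → fl u + fa u) (innerBase ++ [ (n , 0) ])
        ≡⟨ ⨁-++ (λ u → fl u + fa u) innerBase [ (n , 0) ] ⟩
      ⨁ (λ u → fl u + fa u) innerBase + ((fl (n , 0) + fa (n , 0)) + 0)
        ≡⟨ cong₂ _+_ (⨁-ε (inner-zero (λ u → fl u + fa u) λ i≤m → cong₂ _+_ (if-inner i≤m) (if-inner i≤m)))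
                     (ℕ.+-identityʳ _) ⟩
      fl (n , 0) + fa (n , 0)
        ≡⟨ last-balance ⟩
      fe (n , 0) + lowColumns
        ≡⟨ cong (_+ lowColumns) (sym (trans (⨁-++ fe innerBase [ (n , 0) ])
              (cong₂ _+_ (⨁-ε (inner-zero fe if-inner)) (ℕ.+-identityʳ _)))) ⟩
      ⨁ fe (innerBase ++ [ (n , 0) ]) + lowColumns
        ≡⟨ cong (λ b → ⨁ fe b + lowColumns) (sym baseRow-μ) ⟩
      ⨁ fe (baseRow μ) + lowColumns ∎
      where
      open ≡-Reasoning
      fl fa fe : Box → ℕ
      fl = atN (later μ)
      fa = atN (arm μ ∘ above)
      fe = atN (earlier μ)
      if-inner : ∀ {i} {x : ℕ} → i ≤ m → (if i ≡ᵇ n then x else 0) ≡ 0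
      if-inner i≤m rewrite inner-≡ᵇ-last i≤m = refl
      inner-zero : ∀ (g : Box → ℕ) → (∀ {i} → i ≤ m → g (i , 0) ≡ 0) → All (λ u → g u ≡ 0) innerBase
      inner-zero g g0 = All.map⁺ (All.map (λ (_ , i≤m) → g0 i≤m) (range1-bounds m))
      last-balance : fl (n , 0) + fa (n , 0) ≡ fe (n , 0) + lowColumns
      last-balance rewrite ≡ᵇ-refl n =
        trans (later+arm-above≡earlier+#lower μ n (ℕ.≤-reflexive length-μ))
              (cong (earlier μ (n , 0) +_) #lower≡lowColumns)

    laterN+armBelowN : laterN + armBelowN ≡ earlierN + (armN + lowColumns)
    laterN+armBelowN = begin
      laterN + armBelowN
        ≡⟨ cong₂ _+_ laterN≡ (sym armAboveN≡armBelowN) ⟩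
      ⨁ (atN (later μ)) (dgHat μ) + ⨁ (atN (arm μ ∘ above)) (dgHat μ)
        ≡⟨ sym (⨁-∙ (atN (later μ)) (atN (arm μ ∘ above)) (dgHat μ)) ⟩
      ⨁ f (dg' μ ++ baseRow μ)
        ≡⟨ ⨁-++ f (dg' μ) (baseRow μ) ⟩
      ⨁ f (dg' μ) + ⨁ f (baseRow μ)
        ≡⟨ cong₂ _+_ (trans (⨁-cong-local (All.map cell-balance dg'-μ-cells)) (⨁-∙ (atN (earlier μ)) (atN (arm μ)) (dg' μ)))
                     baseRow-balance ⟩
      (⨁ (atN (earlier μ)) (dg' μ) + armN) + (⨁ (atN (earlier μ)) (baseRow μ) + lowColumns)
        ≡⟨ rearrange (⨁ (atN (earlier μ)) (dg' μ)) armN (⨁ (atN (earlier μ)) (baseRow μ)) lowColumns ⟩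
      (⨁ (atN (earlier μ)) (dg' μ) + ⨁ (atN (earlier μ)) (baseRow μ)) + (armN + lowColumns)
        ≡⟨ cong (_+ (armN + lowColumns)) (trans (sym (⨁-++ (atN (earlier μ)) (dg' μ) (baseRow μ))) (sym earlierN≡)) ⟩
      earlierN + (armN + lowColumns) ∎
      where
      open ≡-Reasoning
      f : Box → ℕ
      f u = atN (later μ) u + atN (arm μ ∘ above) u
      rearrange : ∀ a b x y → (a + b) + (x + y) ≡ (a + x) + (b + y)
      rearrange = solve-∀

    #N : ℕ
    #N = count (λ u → hat σ u ≡ᵇ n) (dg' μ)

    legs-telescope-column : ∀ i →
      ⨁ (λ j → belowN (suc ∘ leg μ) (i , j)) (range1 (at μ i)) + ⨁ (λ j → ⟦ hat σ (i , j) ≡ᵇ n ⟧) (range1 (at μ i))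
      ≡ ⨁ (λ j → atN (suc ∘ leg μ) (i , j)) (range1 (at μ i)) + at μ i ℕ.* ⟦ i ≡ᵇ n ⟧
    legs-telescope-column i = begin
      ⨁ (λ j → belowN (suc ∘ leg μ) (i , j)) (range1 M) + ⨁ a (range1 M)
        ≡⟨ cong (_+ ⨁ a (range1 M)) (⨁-cong (λ j → if≡⟦⟧* (hat σ (i , j ∸ 1) ≡ᵇ n) (suc (M ∸ j))) (range1 M)) ⟩
      ⨁ (λ j → a (j ∸ 1) ℕ.* suc (M ∸ j)) (range1 M) + ⨁ a (range1 M)
        ≡⟨ column-telescope M a ⟩
      ⨁ (λ j → a j ℕ.* suc (M ∸ j)) (range1 M) + M ℕ.* a 0
        ≡⟨ cong (_+ M ℕ.* a 0) (⨁-cong (λ j → sym (if≡⟦⟧* (hat σ (i , j) ≡ᵇ n) (suc (M ∸ j)))) (range1 M)) ⟩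
      ⨁ (λ j → atN (suc ∘ leg μ) (i , j)) (range1 M) + M ℕ.* a 0 ∎
      where
      open ≡-Reasoning
      M : ℕ
      M = at μ i
      a : ℕ → ℕ
      a j = ⟦ hat σ (i , j) ≡ᵇ n ⟧

    legs-telescope : ⨁ (belowN (suc ∘ leg μ)) (dg' μ) + #N ≡ ⨁ (atN (suc ∘ leg μ)) (dg' μ) + c
    legs-telescope = begin
      ⨁ (belowN (suc ∘ leg μ)) (dg' μ) + #N
        ≡⟨ cong₂ _+_ (⨁-dg' μ (belowN (suc ∘ leg μ))) (trans (count≡⨁⟦⟧ _ (dg' μ)) (⨁-dg' μ _)) ⟩
      ⨁ belowCol cols + ⨁ countCol cols          ≡⟨ sym (⨁-∙ belowCol countCol cols) ⟩
      ⨁ (λ i → belowCol i + countCol i) cols     ≡⟨ ⨁-cong legs-telescope-column cols ⟩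
      ⨁ (λ i → atCol i + heightN i) cols         ≡⟨ ⨁-∙ atCol heightN cols ⟩
      ⨁ atCol cols + ⨁ heightN cols              ≡⟨ cong₂ _+_ (sym (⨁-dg' μ (atN (suc ∘ leg μ)))) height-of-last ⟩
      ⨁ (atN (suc ∘ leg μ)) (dg' μ) + c          ∎
      where
      open ≡-Reasoning
      cols : List ℕ
      cols = range1 (length μ)
      belowCol countCol atCol heightN : ℕ → ℕ
      belowCol i = ⨁ (λ j → belowN (suc ∘ leg μ) (i , j)) (range1 (at μ i))
      countCol i = ⨁ (λ j → ⟦ hat σ (i , j) ≡ᵇ n ⟧) (range1 (at μ i))
      atCol i    = ⨁ (λ j → atN (suc ∘ leg μ) (i , j)) (range1 (at μ i))
      heightN i  = at μ i ℕ.* ⟦ i ≡ᵇ n ⟧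
      height-of-last : ⨁ heightN cols ≡ c
      height-of-last rewrite ⨁-columns-μ heightN | ≡ᵇ-refl n | at-μ-last =
        trans (cong (_+ c ℕ.* 1) (⨁-ε (All.map (λ {i} (_ , i≤m) → trans (cong (λ b → at μ i ℕ.* ⟦ b ⟧) (inner-≡ᵇ-last i≤m))
                                                                       (ℕ.*-zeroʳ (at μ i))) (range1-bounds m))))
              (ℕ.*-identityʳ c)

    maj-σ' : maj μ' σ' + #N ≡ maj μ σ + c
    maj-σ' = ℕ.+-cancelʳ-≡ W _ _ (begin
      maj μ' σ' + #N + W        ≡⟨ swap-last (maj μ' σ') #N W ⟩
      (maj μ' σ' + W) + #N      ≡⟨ cong (_+ #N) (trans (cong (_+ W) (⨁-Des μ' σ' (suc ∘ leg μ')))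
                                        (trans (descents-rotate (suc ∘ leg μ') (suc ∘ leg μ) (λ (u∈ , _) → cong suc (leg-rotate u∈)))
                                               (cong (_+ W↓) (sym (⨁-Des μ σ (suc ∘ leg μ)))))) ⟩
      (maj μ σ + W↓) + #N       ≡⟨ ℕ.+-assoc (maj μ σ) W↓ #N ⟩
      maj μ σ + (W↓ + #N)       ≡⟨ cong (maj μ σ +_) legs-telescope ⟩
      maj μ σ + (W + c)         ≡⟨ sym (swap-last' (maj μ σ) W c) ⟩
      maj μ σ + c + W           ∎)
      where
      open ≡-Reasoning
      W W↓ : ℕ
      W  = ⨁ (atN (suc ∘ leg μ)) (dg' μ)
      W↓ = ⨁ (belowN (suc ∘ leg μ)) (dg' μ)
      swap-last : ∀ x y z → x + y + z ≡ (x + z) + y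
      swap-last = solve-∀
      swap-last' : ∀ x y z → x + z + y ≡ x + (y + z)
      swap-last' = solve-∀

    coinv-σ' : coinv μ' σ' ≡ coinv μ σ
    coinv-σ' = coinv-balance ⨁-arm-μ' numPairs-μ' numPairs-μ
      numInv-σ'
      (trans (cong (_+ armN) (⨁-Des μ' σ' (arm μ')))
             (trans (descents-rotate (arm μ') (arm μ) (λ { {i , suc j} (i∈ , _) → arm-rotate j i∈ }))
                    (cong (_+ armBelowN) (sym (⨁-Des μ σ (arm μ))))))
      laterN+armBelowN

    module Weights (x₁ : ℚ) (xs : List ℚ) (|xs| : length xs ≡ m) (q t : ℚ) where

      x x' : List ℚ
      x  = x₁ ∷ xs
      x' = xs ++ [ inv q * x₁ ]

      factor : List ℕ → Box → ℚ
      factor κ u = (1ℚ - t) * inv (1ℚ - (q ^ suc (leg κ u)) * (t ^ suc (arm κ u)))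

      jump : Filling → Box → Bool
      jump τ u = not (hat τ u ≡ᵇ hat τ (d u))

      monomial : ℚ
      monomial = ∏ℚ.⨁ (λ u → xAt x (cycle (hat σ u))) (dg' μ)

      monomial-σ' : ∏ℚ.⨁ (λ u → xAt x (hat σ' u)) (dg' μ') ≡ x₁ * monomial
      monomial-σ' = trans (∏-Transfer.⨁-dg'-μ' (λ u → xAt x (hat σ' u)))
        (cong₂ _*_ (cong (xAt x) hat-σ'-corner) (∏ℚ.⨁-cong-local (All.map (λ (i∈ , _) → cong (xAt x) (hat-rotate i∈)) dg'-μ-cells)))

      monomial-σ : ∏ℚ.⨁ (λ u → xAt x' (hat σ u)) (dg' μ) ≡ inv q ^ #N * monomial
      monomial-σ = begin
        ∏ℚ.⨁ (λ u → xAt x' (hat σ u)) (dg' μ)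
          ≡⟨ ∏ℚ.⨁-cong-local (All.map (λ u∈ → xAt-rotated x₁ xs |xs| (inv q) (proj₁ (valued-cell u∈))) dg'-μ-cells) ⟩
        ∏ℚ.⨁ (λ u → (if hat σ u ≡ᵇ n then inv q else 1ℚ) * xAt x (cycle (hat σ u))) (dg' μ)
          ≡⟨ ∏ℚ.⨁-∙ (λ u → if hat σ u ≡ᵇ n then inv q else 1ℚ) (λ u → xAt x (cycle (hat σ u))) (dg' μ) ⟩
        ∏ℚ.⨁ (λ u → if hat σ u ≡ᵇ n then inv q else 1ℚ) (dg' μ) * monomial
          ≡⟨ cong (_* monomial) (∏-if≡^count (λ u → hat σ u ≡ᵇ n) (inv q) (dg' μ)) ⟩
        inv q ^ #N * monomial ∎
        where open ≡-Reasoning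

      factors-σ' : ∏ℚ.⨁ (factor μ') (filterᵇ (jump σ') (dg' μ')) ≡ ∏ℚ.⨁ (factor μ) (filterᵇ (jump σ) (dg' μ))
      factors-σ' = begin
        ∏ℚ.⨁ (factor μ') (filterᵇ (jump σ') (dg' μ'))
          ≡⟨ ∏ℚ.⨁-filterᵇ (factor μ') (jump σ') (dg' μ') ⟩
        ∏ℚ.⨁ (if-jump σ' μ') (dg' μ')
          ≡⟨ ∏-Transfer.⨁-dg'-μ' (if-jump σ' μ') ⟩
        if-jump σ' μ' (1 , 1) * ∏ℚ.⨁ (if-jump σ' μ' ∘ rotate) (dg' μ)
          ≡⟨ cong₂ _*_ corner (∏ℚ.⨁-cong-local (All.map rotated dg'-μ-cells)) ⟩
        1ℚ * ∏ℚ.⨁ (if-jump σ μ) (dg' μ)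
          ≡⟨ ℚ.*-identityˡ _ ⟩
        ∏ℚ.⨁ (if-jump σ μ) (dg' μ)
          ≡⟨ sym (∏ℚ.⨁-filterᵇ (factor μ) (jump σ) (dg' μ)) ⟩
        ∏ℚ.⨁ (factor μ) (filterᵇ (jump σ) (dg' μ)) ∎
        where
        open ≡-Reasoning
        if-jump : Filling → List ℕ → Box → ℚ
        if-jump τ κ u = if jump τ u then factor κ u else 1ℚ
        corner : if-jump σ' μ' (1 , 1) ≡ 1ℚ
        corner rewrite hat-σ'-corner = refl
        rotated : ∀ {u} → Cell u → if-jump σ' μ' (rotate u) ≡ if-jump σ μ u
        rotated {i , suc j} u∈@(i∈ , _) = cong₂ (λ b f → if b then f else 1ℚ)
          (cong not (trans (cong₂ _≡ᵇ_ (hat-rotate i∈) (trans (cong (hat σ') (d-rotate j i∈)) (hat-rotate i∈)))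
                           (cycle-≡ᵇ (proj₁ (valued-cell u∈)) (proj₂ (valued-cell u∈)))))
          (cong₂ (λ l a → (1ℚ - t) * inv (1ℚ - (q ^ suc l) * (t ^ suc a))) (leg-rotate i∈) (arm-rotate j i∈))

      term-σ' : q ≢ 0ℚ → term μ' x q t σ' ≡ q ^ c * x₁ * term μ x' q t σ
      term-σ' q≢0 = begin
        ((X' * q ^ maj μ' σ') * (t ^ℤ coinv μ' σ')) * F'
          ≡⟨ cong₂ (λ a b → ((a * b) * (t ^ℤ coinv μ' σ')) * F') monomial-σ' (^-shift q≢0 (maj μ' σ') #N (maj μ σ) c maj-σ') ⟩
        ((x₁ * Y) * (q ^ c * (inv q ^ #N * q ^ maj μ σ))) * (t ^ℤ coinv μ' σ') * F'
          ≡⟨ cong₂ (λ a b → ((x₁ * Y) * (q ^ c * (inv q ^ #N * q ^ maj μ σ))) * (t ^ℤ a) * b) coinv-σ' factors-σ' ⟩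
        ((x₁ * Y) * (q ^ c * (inv q ^ #N * q ^ maj μ σ))) * (t ^ℤ coinv μ σ) * F
          ≡⟨ rearrange x₁ Y (q ^ c) (inv q ^ #N) (q ^ maj μ σ) (t ^ℤ coinv μ σ) F ⟩
        (q ^ c * x₁) * (((inv q ^ #N * Y) * q ^ maj μ σ) * (t ^ℤ coinv μ σ) * F)
          ≡⟨ cong (λ z → (q ^ c * x₁) * ((z * q ^ maj μ σ) * (t ^ℤ coinv μ σ) * F)) (sym monomial-σ) ⟩
        q ^ c * x₁ * term μ x' q t σ ∎
        where
        open ≡-Reasoning
        X' Y F' F : ℚ
        X' = ∏ℚ.⨁ (λ u → xAt x (hat σ' u)) (dg' μ')
        Y  = monomial
        F' = ∏ℚ.⨁ (factor μ') (filterᵇ (jump σ') (dg' μ'))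
        F  = ∏ℚ.⨁ (factor μ) (filterᵇ (jump σ) (dg' μ))
        rearrange : ∀ x₁ Y qc ik qM T F → ((x₁ * Y) * (qc * (ik * qM))) * T * F
                                          ≡ (qc * x₁) * (((ik * Y) * qM) * T * F)
        rearrange = solve 7 (λ x₁ Y qc ik qM T F → ((x₁ :* Y) :* (qc :* (ik :* qM))) :* T :* F
                                                 := (qc :* x₁) :* (((ik :* Y) :* qM) :* T :* F)) refl
          where open +-*-Solver

  cycle-↭ : map cycle (range1 n) ↭ range1 n
  cycle-↭ = ↭-trans (↭-reflexive cycled) (↭-trans (↭-sym (↭.∷↭∷ʳ 1 (map suc (range1 m)))) (↭-reflexive (sym (range1-suc m))))
    where
    cycled : map cycle (range1 n) ≡ map suc (range1 m) ++ [ 1 ]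
    cycled = trans (cong (map cycle) (range1-∷ʳ m)) (trans (List.map-++ cycle (range1 m) [ n ])
      (cong₂ _++_ (List.map-cong-local (All.map cycle-inner (range1-bounds m))) (cong [_] cycle-last)))

  -- the box (1 , 1) attacks (a , 0), which carries the value a
  attacking-first-value : ∀ {a} → a ∈[1, m ] → ∀ w → nonAttacking μ' (zip (dg' μ') (suc a ∷ w)) ≡ false
  attacking-first-value {suc a} (_ , a<m) w =
    trans (nonAttacking≡⋀ μ' τ) (⋀-false {p = row} corner∈ (⋀-false {p = compatible τ (1 , 1)} base∈ clash))
    where
    τ : Filling
    τ = zip (dg' μ') (suc (suc a) ∷ w)
    row : Box → Bool
    row u = ⋀.⨁ (compatible τ u) (dgHat μ')
    corner∈ : (1 , 1) ∈ dgHat μ'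
    corner∈ = ∈-++⁺ˡ (subst ((1 , 1) ∈_) (sym dg'-μ') (here refl))
    base∈ : (suc (suc a) , 0) ∈ dgHat μ'
    base∈ = ∈-++⁺ʳ (dg' μ') (∈-map⁺ (_, 0) (∈-range1 (s≤s z≤n , s≤s a<m)))
    clash : compatible τ (1 , 1) (suc (suc a) , 0) ≡ false
    clash = trans (cong (λ h → not (attacks (1 , 1) (suc (suc a) , 0)) ∨ not (h ≡ᵇ suc (suc a)))
                        (cong (λ L → lookupF (zip L (suc (suc a) ∷ w)) (1 , 1)) dg'-μ'))
                  (cong (λ b → false ∨ not b) (≡ᵇ-refl a))

  module Summation (x₁ : ℚ) (xs : List ℚ) (|xs| : length xs ≡ m) (q t : ℚ) (q≢0 : q ≢ 0ℚ) where

    x x' : List ℚ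
    x  = x₁ ∷ xs
    x' = xs ++ [ inv q * x₁ ]

    K : ℚ
    K = q ^ c * x₁

    L : ℕ
    L = length innerColumns

    W' W : List ℕ → ℚ
    W' = weight μ' x q t
    W  = weight μ x' q t

    Cℓ-μ'≡first-value-1 : Cℓ μ' x q t ≡ ∑ℚ.⨁ (λ w → W' (1 ∷ w)) (words n (c + L))
    Cℓ-μ'≡first-value-1 = begin
      Cℓ μ' x q t
        ≡⟨ trans (Cℓ≡⨁weight μ' x q t) (cong (λ l → ∑ℚ.⨁ W' (words n l)) length-dg'-μ') ⟩
      ∑ℚ.⨁ W' (words n (suc (c + L)))
        ≡⟨ ∑ℚ.⨁-concatMap W' (λ a → map (a ∷_) (words n (c + L))) (range1 n) ⟩
      ∑ℚ.⨁ (λ a → ∑ℚ.⨁ W' (map (a ∷_) (words n (c + L)))) (range1 n)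
        ≡⟨ cong (∑ℚ.⨁ (λ a → ∑ℚ.⨁ W' (map (a ∷_) (words n (c + L))))) (range1-suc m) ⟩
      ∑ℚ.⨁ W' (map (1 ∷_) (words n (c + L))) ℚ.+ ∑ℚ.⨁ (λ a → ∑ℚ.⨁ W' (map (a ∷_) (words n (c + L)))) (map suc (range1 m))
        ≡⟨ cong₂ ℚ._+_ (∑ℚ.⨁-map W' (1 ∷_) (words n (c + L))) other-values ⟩
      ∑ℚ.⨁ (λ w → W' (1 ∷ w)) (words n (c + L)) ℚ.+ 0ℚ
        ≡⟨ ℚ.+-identityʳ _ ⟩
      ∑ℚ.⨁ (λ w → W' (1 ∷ w)) (words n (c + L)) ∎
      where
      open ≡-Reasoning
      other-values : ∑ℚ.⨁ (λ a → ∑ℚ.⨁ W' (map (a ∷_) (words n (c + L)))) (map suc (range1 m)) ≡ 0ℚ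
      other-values = trans (∑ℚ.⨁-map _ suc (range1 m)) (∑ℚ.⨁-ε (All.map (λ {a} a∈ →
        trans (∑ℚ.⨁-map W' (suc a ∷_) (words n (c + L)))
              (∑ℚ.⨁-ε (All.universal (λ w → cong (λ b → if b then term μ' x q t (zip (dg' μ') (suc a ∷ w)) else 0ℚ)
                                                 (attacking-first-value a∈ w)) (words n (c + L)))))
        (range1-bounds m)))

    rotated-fillings : ∀ {wLast wInner} →
      (length wLast ≡ c × All (_∈[1, n ]) wLast) → (length wInner ≡ L × All (_∈[1, n ]) wInner) →
      W' (1 ∷ (map cycle wLast ++ map cycle wInner)) ≡ K * W (wInner ++ wLast)
    rotated-fillings {wLast} {wInner} (|wLast| , wLast-range) (|wInner| , wInner-range)
      rewrite Filling.nonAttacking-σ' wLast wInner |wLast| |wInner| wLast-range wInner-range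
      with nonAttacking μ (zip (dg' μ) (wInner ++ wLast))
    ... | true  = Filling.Weights.term-σ' wLast wInner |wLast| |wInner| wLast-range wInner-range x₁ xs |xs| q t q≢0
    ... | false = sym (ℚ.*-zeroʳ K)

    C-rotation : Cℓ μ' x q t ≡ K * Cℓ μ x' q t
    C-rotation = begin
      Cℓ μ' x q t
        ≡⟨ Cℓ-μ'≡first-value-1 ⟩
      ⨁' (λ w → W' (1 ∷ w)) (words n (c + L))
        ≡⟨ ∑ℚ.⨁-words-+ n c L (λ w → W' (1 ∷ w)) ⟩
      ⨁' (λ w₁ → ⨁' (λ w₂ → W' (1 ∷ (w₁ ++ w₂))) (words n L)) (words n c)
        ≡⟨ sym (∑ℚ.⨁-words-map n cycle cycle-↭ c (λ w₁ → ⨁' (λ w₂ → W' (1 ∷ (w₁ ++ w₂))) (words n L))) ⟩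
      ⨁' (λ w₁ → ⨁' (λ w₂ → W' (1 ∷ (map cycle w₁ ++ w₂))) (words n L)) (words n c)
        ≡⟨ ∑ℚ.⨁-cong (λ w₁ → sym (∑ℚ.⨁-words-map n cycle cycle-↭ L (λ w₂ → W' (1 ∷ (map cycle w₁ ++ w₂))))) (words n c) ⟩
      ⨁' (λ w₁ → ⨁' (λ w₂ → W' (1 ∷ (map cycle w₁ ++ map cycle w₂))) (words n L)) (words n c)
        ≡⟨ ∑ℚ.⨁-cong-local (All.map (λ w₁∈ → ∑ℚ.⨁-cong-local (All.map (rotated-fillings w₁∈) (All.zip (words-length n L , words-range n L))))
                              (All.zip (words-length n c , words-range n c))) ⟩
      ⨁' (λ w₁ → ⨁' (λ w₂ → K * W (w₂ ++ w₁)) (words n L)) (words n c)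
        ≡⟨ sym (trans (scale (λ w₁ → ⨁' (λ w₂ → W (w₂ ++ w₁)) (words n L)) (words n c))
                      (∑ℚ.⨁-cong (λ w₁ → scale (λ w₂ → W (w₂ ++ w₁)) (words n L)) (words n c))) ⟩
      K * ⨁' (λ w₁ → ⨁' (λ w₂ → W (w₂ ++ w₁)) (words n L)) (words n c)
        ≡⟨ cong (K *_) (∑ℚ.⨁-comm (λ w₁ w₂ → W (w₂ ++ w₁)) (words n c) (words n L)) ⟩
      K * ⨁' (λ w₂ → ⨁' (λ w₁ → W (w₂ ++ w₁)) (words n c)) (words n L)
        ≡⟨ cong (K *_) (sym (∑ℚ.⨁-words-+ n L c W)) ⟩
      K * ⨁' W (words n (L + c))
        ≡⟨ cong (K *_) (sym (trans (Cℓ≡⨁weight μ x' q t) (cong₂ (λ k l → ⨁' W (words k l)) length-μ length-dg'-μ))) ⟩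
      K * Cℓ μ x' q t ∎
      where
      open ≡-Reasoning
      ⨁' : ∀ {B : Set} → (B → ℚ) → List B → ℚ
      ⨁' = ∑ℚ.⨁
      scale : ∀ {B : Set} (f : B → ℚ) xs → K * ⨁' f xs ≡ ⨁' (λ y → K * f y) xs
      scale = ∑ℚ.⨁-homo (K *_) (ℚ.*-zeroʳ K) (ℚ.*-distribˡ-+ K)

corollary4p3 : (m : ℕ) (μ : Vec ℕ (suc m)) (x : Vec ℚ (suc m)) (q t : ℚ)
    → q ≢ 0ℚ → t ≢ 0ℚ
    → (∀ a b → (q ^ suc a) * (t ^ suc b) ≢ 1ℚ)
    → C (π μ) x q t ≡ (q ^ last μ) * head x * C μ (shiftX q x) q t
corollary4p3 m μ (x₁ ∷ xs) q t q≢0 _ _ =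
  trans (Rotation.Summation.C-rotation ν (last μ) x₁ (Vec.toList xs) |xs| q t q≢0)
        (cong₂ (λ κ y → q ^ last μ * x₁ * Cℓ κ y q t) (sym μ≡ν∷ʳlast) (sym (Vec.toList-∷ʳ (inv q * x₁) xs)))
  where
  ν : List ℕ
  ν = Vec.toList (Vec.init μ)
  |xs| : length (Vec.toList xs) ≡ length ν
  |xs| = trans (Vec.length-toList xs) (sym (Vec.length-toList (Vec.init μ)))
  μ≡ν∷ʳlast : Vec.toList μ ≡ ν ++ [ last μ ]
  μ≡ν∷ʳlast = trans (cong Vec.toList (proj₂ (proj₂ (Vec.initLast μ)))) (Vec.toList-∷ʳ (last μ) (Vec.init μ))
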